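{- Let $\mathbf d$ be a sequence of length $n$ and let $\mathcal A\subseteq\binom{[n]}2$. (a) Let $a,v\in[n]$. If $\mathcal N_{av}(\mathbf d)>0$ then $$P_{av}(\mathbf d)=d_v\Bigg(\sum_{b\in\mathcal A^*(v)}R_{ba}(\mathbf d-\mathbf e_v)\frac{1-P_{bv}(\mathbf d-\mathbf e_b-\mathbf e_v)}{1-P_{av}(\mathbf d-\mathbf e_a-\mathbf e_v)}\Bigg)^{ -1}.$$ (b) Let $a,b\in[n]$. If $\mathbf d-\mathbf e_b$ is $\mathcal A$-realisable and $B(b,a,\mathbf d-\mathbf e_a)\ne1$, then $$R_{ab}(\mathbf d)=\frac{d_a}{d_b}\cdot\frac{1-B(a,b,\mathbf d-\mathbf e_b)}{1-B(b,a,\mathbf d-\mathbf e_a)},$$ where $$B(i,j,\mathbf d')=\frac1{d_i}\Bigg(\sum_{v\in\mathcal A(i)\setminus\mathcal A(j)}P_{iv}(\mathbf d')+\sum_{v\in\mathcal A(i)\cap\mathcal A(j)}P_{ivj}(\mathbf d')\Bigg).$$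
   Context: $\mathcal A\subseteq\binom{[n]}2$ is a set of allowable pairs. A sequence $\mathbf d$ is $\mathcal A$-realisable if there is a simple graph on $[n]$ with vertex $i$ of degree $d_i$ for all $i$ and all edges in $\mathcal A$; $\mathcal G_{\mathcal A}(\mathbf d)$ is the set of such graphs and $\mathcal N(\mathbf d)=|\mathcal G_{\mathcal A}(\mathbf d)|$. For a set $E\subseteq\mathcal A$, $\mathcal N_E(\mathbf d)$ is the number of graphs in $\mathcal G_{\mathcal A}(\mathbf d)$ containing all edges of $E$, $P_E(\mathbf d)=\mathcal N_E(\mathbf d)/\mathcal N(\mathbf d)$, $P_{av}(\mathbf d)=P_{\{av\}}(\mathbf d)$, $P_{avb}(\mathbf d)=P_{\{av,bv\}}(\mathbf d)$, and $\mathcal N_{av}(\mathbf d)=\mathcal N_{\{av\}}(\mathbf d)$. $R_{ab}(\mathbf d)=\mathcal N(\mathbf d-\mathbf e_a)/\mathcal N(\mathbf d-\mathbf e_b)$, where $\mathbf e_a$ is the $a$th unit vector. $\mathcal A(a)=\{v\in[n]:\{a,v\}\in\mathcal A\}$, and $\mathcal A^*(v)$ is the set of $b\in\mathcal A(v)$ with $\mathcal N_{bv}(\mathbf d)>0$. -}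

module Defs where

open import Data.Bool using (Bool; true; false; _∧_; _∨_; not; if_then_else_)
open import Data.Nat as ℕ using (ℕ; zero; suc)
open import Data.Integer as ℤ using (ℤ; +_)
open import Data.Fin as Fin using (Fin)
open import Data.Fin.Properties as FinP using ()
open import Data.List using (List; []; _∷_; _++_; map; filter; length; foldr; concatMap; allFin)
open import Data.Bool.ListAction using (any; all)
open import Data.Product using (_×_; _,_)
open import Data.Rational as ℚ using (ℚ; 0ℚ; 1ℚ; _*_; _+_; _-_; 1/_)
open import Data.Rational.Properties using ()
open import Relation.Nullary using (yes; no; does)
open import Relation.Binary.PropositionalEquality using (_≡_)

-- Total division on ℚ with the convention p ÷₀ 0 = 0.
_÷₀_ : ℚ → ℚ → ℚ
p ÷₀ q with q ℚ.≟ 0ℚ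
... | yes _ = 0ℚ
... | no q≢0 = p * (1/ q) {{ℚ.≢-nonZero q≢0}}

ℕ→ℚ : ℕ → ℚ
ℕ→ℚ k = (+ k) ℚ./ 1

ℤ→ℚ : ℤ → ℚ
ℤ→ℚ z = z ℚ./ 1

sumℚ : List ℚ → ℚ
sumℚ = foldr _+_ 0ℚ

_==_ : ∀ {n} → Fin n → Fin n → Bool
i == j = does (i Fin.≟ j)

_<ᵇ_ : ∀ {n} → Fin n → Fin n → Bool
i <ᵇ j = does (i Fin.<? j)

-- A set of allowable pairs 𝒜 ⊆ ([n] choose 2) is given by a Boolean
-- function A; the unordered pair {i,j} (i ≠ j) belongs to 𝒜 iff
-- A (min i j) (max i j) = true.  (The values of A at i ≥ j are ignored,
-- so every subset of ([n] choose 2) is represented.)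
Allowed : ℕ → Set
Allowed n = Fin n → Fin n → Bool

adj : ∀ {n} → Allowed n → Fin n → Fin n → Bool
adj A i j = if i <ᵇ j then A i j else (if j <ᵇ i then A j i else false)

pairs : (n : ℕ) → List (Fin n × Fin n)
pairs n = concatMap (λ i → map (λ j → (i , j)) (filter (λ j → i Fin.<? j) (allFin n))) (allFin n)

sublists : {X : Set} → List X → List (List X)
sublists [] = [] ∷ []
sublists (x ∷ xs) = let r = sublists xs in r ++ map (x ∷_) r

-- A simple graph on [n] is a set of pairs i < j; all simple graphs:
Graph : ℕ → Set
Graph n = List (Fin n × Fin n)

allGraphs : (n : ℕ) → List (Graph n)
allGraphs n = sublists (pairs n)

hasEdge : ∀ {n} → Graph n → Fin n → Fin n → Bool
hasEdge G u v = any (λ { (i , j) → ((i == u) ∧ (j == v)) ∨ ((i == v) ∧ (j == u)) }) G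

deg : ∀ {n} → Graph n → Fin n → ℕ
deg G v = length (filter (λ { (i , j) → (i Fin.≟ v) Relation.Nullary.⊎-dec (j Fin.≟ v) }) G)
  where import Relation.Nullary

inG : ∀ {n} → Allowed n → (Fin n → ℤ) → Graph n → Bool
inG {n} A d G = all (λ { (i , j) → adj A i j }) G ∧ all (λ i → does (+ deg G i ℤ.≟ d i)) (allFin n)

containsAll : ∀ {n} → Graph n → List (Fin n × Fin n) → Bool
containsAll G E = all (λ { (u , v) → hasEdge G u v }) E

𝒩 : ∀ {n} → Allowed n → (Fin n → ℤ) → ℕ
𝒩 {n} A d = length (filter (λ G → inG A d G Data.Bool.≟ true) (allGraphs n))

𝒩E : ∀ {n} → Allowed n → (Fin n → ℤ) → List (Fin n × Fin n) → ℕ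
𝒩E {n} A d E = length (filter (λ G → (inG A d G ∧ containsAll G E) Data.Bool.≟ true) (allGraphs n))

Realisable : ∀ {n} → Allowed n → (Fin n → ℤ) → Set
Realisable A d = 0 ℕ.< 𝒩 A d

_-e_ : ∀ {n} → (Fin n → ℤ) → Fin n → (Fin n → ℤ)
(d -e a) i = if i == a then d i ℤ.- + 1 else d i

PE : ∀ {n} → Allowed n → (Fin n → ℤ) → List (Fin n × Fin n) → ℚ
PE A d E = ℕ→ℚ (𝒩E A d E) ÷₀ ℕ→ℚ (𝒩 A d)

𝒩edge : ∀ {n} → Allowed n → (Fin n → ℤ) → Fin n → Fin n → ℕ
𝒩edge A d a v = 𝒩E A d ((a , v) ∷ [])

Pe : ∀ {n} → Allowed n → (Fin n → ℤ) → Fin n → Fin n → ℚ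
Pe A d a v = PE A d ((a , v) ∷ [])

Ppath : ∀ {n} → Allowed n → (Fin n → ℤ) → Fin n → Fin n → Fin n → ℚ
Ppath A d a v b = PE A d ((a , v) ∷ (b , v) ∷ [])

R : ∀ {n} → Allowed n → Fin n → Fin n → (Fin n → ℤ) → ℚ
R A a b d = ℕ→ℚ (𝒩 A (d -e a)) ÷₀ ℕ→ℚ (𝒩 A (d -e b))

𝒜 : ∀ {n} → Allowed n → Fin n → List (Fin n)
𝒜 {n} A a = filter (λ v → adj A a v Data.Bool.≟ true) (allFin n)

𝒜* : ∀ {n} → Allowed n → (Fin n → ℤ) → Fin n → List (Fin n)
𝒜* {n} A d v = filter (λ b → adj A v b Data.Bool.≟ true) (filter (λ b → 0 ℕ.<? 𝒩edge A d b v) (allFin n))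

Bf : ∀ {n} → Allowed n → Fin n → Fin n → (Fin n → ℤ) → ℚ
Bf {n} A i j d' =
  (1ℚ ÷₀ ℤ→ℚ (d' i)) *
    (sumℚ (map (λ v → Pe A d' i v)
                (filter (λ v → (adj A i v ∧ not (adj A j v)) Data.Bool.≟ true) (allFin n)))
     + sumℚ (map (λ v → Ppath A d' i v j)
                (filter (λ v → (adj A i v ∧ adj A j v) Data.Bool.≟ true) (allFin n))))

module Submission where

-- A graph on [n] is a sublist of `pairs n`, i.e. a bit vector over it, so every
-- count 𝒩 is a count of bit vectors.  Flipping one bit is a count-preserving
-- involution, and flipping the bit of an allowed pair {a,v} changes d_a and d_v
-- by one.  This gives three identities (module in brackets):
--   (I)   𝒩_av(d) + 𝒩_av(d−e_a−e_v) = 𝒩(d−e_a−e_v) when 𝒩_av(d) > 0  [EdgeToggle]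
--   (II)  Σ_b 𝒩_bv(d) = d_v 𝒩(d)                                     [DegreeSum]
--   (III) for a ≠ b, the graphs of degree d−e_b containing av but not bv
--         (bv allowed) match those of degree d−e_a containing bv but not av
--         [Switching].
-- By (II), d_i 𝒩(D)(1 − B(i,j,D)) counts the graphs in (III) [BComplement], so
-- d_a 𝒩(d−e_b)(1 − B(a,b,d−e_b)) = d_b 𝒩(d−e_a)(1 − B(b,a,d−e_a)), which is (b).
-- By (I) each summand of (a) is 𝒩_bv(d)/𝒩_av(d), and by (II) they add up to
-- d_v 𝒩(d)/𝒩_av(d), which is (a).  As ÷₀ is total, each division is justified
-- by proving its denominator non-zero [Formulas].

open import Defs
open import Data.Bool as Bool using (Bool; true; false; _∧_; _∨_; not; if_then_else_)
import Data.Bool.Properties as BoolP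
open import Data.Bool.ListAction using (any; all)
open import Data.Nat as ℕ using (ℕ; zero; suc; z≤n; s≤s)
import Data.Nat.Properties as ℕP
open import Data.Integer as ℤ using (ℤ)
import Data.Integer.Properties as ℤP
import Data.Integer.Tactic.RingSolver as ℤSolver
open import Data.Rational as ℚ using (ℚ; 0ℚ; 1ℚ)
import Data.Rational.Properties as ℚP
open import Data.List using (List; []; _∷_; _++_; map; filter; length; concat; allFin; tabulate)
import Data.List.Properties as ListP
open import Data.List.Relation.Unary.All using (All; []; _∷_)
import Data.List.Relation.Unary.All.Properties as AllP
open import Data.Product using (Σ; _×_; _,_; proj₁; proj₂)
open import Data.Sum using (_⊎_; inj₁; inj₂)
open import Data.Maybe using (Maybe; just; nothing)
open import Data.Fin as Fin using (Fin)
import Data.Fin.Properties as FinP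
open import Data.Empty using (⊥-elim)
open import Relation.Nullary using (Dec; yes; no; does; ¬_)
open import Relation.Nullary.Decidable using (dec-true; dec-false)
open import Relation.Binary using (tri<; tri≈; tri>)
import Relation.Unary as U
open import Relation.Binary.PropositionalEquality
  using (_≡_; _≢_; refl; sym; trans; cong; cong₂; subst; subst₂; module ≡-Reasoning)
open ≡-Reasoning

module DivisionFacts where

  open import Data.Integer using (+_)
  open import Data.Rational using (_+_; _*_; _-_; 1/_)
  open import Data.Rational.Solver using (module +-*-Solver)
  open +-*-Solver
  import Data.Rational.Unnormalised as ℚᵘ
  import Data.Rational.Unnormalised.Properties as ℚᵘP
  import Data.Nat.Coprimality as Coprimality

  *-cancelʳ : ∀ {x y q : ℚ} → q ≢ 0ℚ → x * q ≡ y * q → x ≡ y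
  *-cancelʳ {x} {y} {q} q≢0 e =
    let instance _ = ℚ.≢-nonZero q≢0 in
    begin
      x                ≡⟨ sym (ℚP.*-identityʳ x) ⟩
      x * 1ℚ           ≡⟨ cong (x *_) (sym (ℚP.*-inverseʳ q)) ⟩
      x * (q * 1/ q)   ≡⟨ sym (ℚP.*-assoc x q (1/ q)) ⟩
      (x * q) * 1/ q   ≡⟨ cong (_* 1/ q) e ⟩
      (y * q) * 1/ q   ≡⟨ ℚP.*-assoc y q (1/ q) ⟩
      y * (q * 1/ q)   ≡⟨ cong (y *_) (ℚP.*-inverseʳ q) ⟩
      y * 1ℚ           ≡⟨ ℚP.*-identityʳ y ⟩
      y ∎

  ÷₀-*-inverse : ∀ {p q : ℚ} → q ≢ 0ℚ → (p ÷₀ q) * q ≡ p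
  ÷₀-*-inverse {p} {q} q≢0 with q ℚ.≟ 0ℚ
  ... | yes q≡0 = ⊥-elim (q≢0 q≡0)
  ... | no q≢0′ =
    let instance _ = ℚ.≢-nonZero q≢0′ in
    begin
      (p * 1/ q) * q  ≡⟨ ℚP.*-assoc p (1/ q) q ⟩
      p * (1/ q * q)  ≡⟨ cong (p *_) (ℚP.*-inverseˡ q) ⟩
      p * 1ℚ          ≡⟨ ℚP.*-identityʳ p ⟩
      p ∎

  ÷₀-unique : ∀ {p q r : ℚ} → q ≢ 0ℚ → p ≡ r * q → p ÷₀ q ≡ r
  ÷₀-unique q≢0 e = *-cancelʳ q≢0 (trans (÷₀-*-inverse q≢0) e)

  ÷₀-self : ∀ {x : ℚ} → x ≢ 0ℚ → x ÷₀ x ≡ 1ℚ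
  ÷₀-self {x} x≢0 = ÷₀-unique x≢0 (sym (ℚP.*-identityˡ x))

  ÷₀-by-0 : ∀ p → p ÷₀ 0ℚ ≡ 0ℚ
  ÷₀-by-0 p with 0ℚ ℚ.≟ 0ℚ
  ... | yes _ = refl
  ... | no 0≢0 = ⊥-elim (0≢0 refl)

  0-÷₀ : ∀ q → 0ℚ ÷₀ q ≡ 0ℚ
  0-÷₀ q with q ℚ.≟ 0ℚ
  ... | yes _ = refl
  ... | no q≢0 = ℚP.*-zeroˡ ((1/ q) {{ℚ.≢-nonZero q≢0}})

  ÷₀-distrib-+ : ∀ x y q → (x + y) ÷₀ q ≡ x ÷₀ q + y ÷₀ q
  ÷₀-distrib-+ x y q = by-cases (q ℚ.≟ 0ℚ)
    where
    by-cases : Dec (q ≡ 0ℚ) → (x + y) ÷₀ q ≡ x ÷₀ q + y ÷₀ q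
    by-cases (no q≢0) = ÷₀-unique q≢0 (sym (begin
        (x ÷₀ q + y ÷₀ q) * q       ≡⟨ ℚP.*-distribʳ-+ q (x ÷₀ q) (y ÷₀ q) ⟩
        (x ÷₀ q) * q + (y ÷₀ q) * q ≡⟨ cong₂ _+_ (÷₀-*-inverse q≢0) (÷₀-*-inverse q≢0) ⟩
        x + y ∎))
    by-cases (yes q≡0) = begin
        (x + y) ÷₀ q        ≡⟨ cong ((x + y) ÷₀_) q≡0 ⟩
        (x + y) ÷₀ 0ℚ       ≡⟨ ÷₀-by-0 (x + y) ⟩
        0ℚ                  ≡⟨ sym (ℚP.+-identityˡ 0ℚ) ⟩
        0ℚ + 0ℚ             ≡⟨ sym (cong₂ _+_ (÷₀-by-0 x) (÷₀-by-0 y)) ⟩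
        x ÷₀ 0ℚ + y ÷₀ 0ℚ   ≡⟨ cong (λ z → x ÷₀ z + y ÷₀ z) (sym q≡0) ⟩
        x ÷₀ q + y ÷₀ q ∎

  sumℚ-÷₀ : ∀ {X : Set} (f : X → ℚ) (q : ℚ) (xs : List X) →
    sumℚ (map (λ x → f x ÷₀ q) xs) ≡ sumℚ (map f xs) ÷₀ q
  sumℚ-÷₀ f q [] = sym (0-÷₀ q)
  sumℚ-÷₀ f q (x ∷ xs) =
    trans (cong (λ z → f x ÷₀ q + z) (sumℚ-÷₀ f q xs)) (sym (÷₀-distrib-+ (f x) _ q))

  sumℚ-cong-All : ∀ {X : Set} {Q : X → Set} {f g : X → ℚ} →
    (∀ x → Q x → f x ≡ g x) → ∀ {xs} → All Q xs → sumℚ (map f xs) ≡ sumℚ (map g xs)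
  sumℚ-cong-All h [] = refl
  sumℚ-cong-All h (q ∷ qs) = cong₂ _+_ (h _ q) (sumℚ-cong-All h qs)

  *-≢0 : ∀ {x y : ℚ} → x ≢ 0ℚ → y ≢ 0ℚ → x * y ≢ 0ℚ
  *-≢0 {x} {y} x≢0 y≢0 e = x≢0 (*-cancelʳ y≢0 (trans e (sym (ℚP.*-zeroˡ y))))

  ÷₀-≢0 : ∀ {x y : ℚ} → x ≢ 0ℚ → y ≢ 0ℚ → x ÷₀ y ≢ 0ℚ
  ÷₀-≢0 {x} {y} x≢0 y≢0 e =
    x≢0 (trans (sym (÷₀-*-inverse y≢0)) (trans (cong (_* y) e) (ℚP.*-zeroˡ y)))

  -- The hypothesis B ≠ 1 of part (b) makes 1 − B invertible.
  1-x≢0 : ∀ {x : ℚ} → x ≢ 1ℚ → 1ℚ - x ≢ 0ℚ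
  1-x≢0 {x} x≢1 e = x≢1 (trans (solve 1 (λ x → x := con 1ℚ :- (con 1ℚ :- x)) refl x)
                                (cong (1ℚ -_) e))

  -- ℤ→ℚ is an injective ring homomorphism; it is checked through the
  -- unnormalised rationals, where z / 1 is literally the pair (z , 1).
  ℤ→ℚ-toℚᵘ : ∀ z → ℚ.toℚᵘ (ℤ→ℚ z) ≡ ℚᵘ.mkℚᵘ z 0
  ℤ→ℚ-toℚᵘ (+ n) =
    cong ℚ.toℚᵘ (ℚP.normalize-coprime {n} {0} (Coprimality.sym (Coprimality.1-coprimeTo n)))
  ℤ→ℚ-toℚᵘ ℤ.-[1+ n ] = cong (λ r → ℚ.toℚᵘ (ℚ.- r))
    (ℚP.normalize-coprime {suc n} {0} (Coprimality.sym (Coprimality.1-coprimeTo (suc n))))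

  ℤ→ℚ-+ : ∀ x y → ℤ→ℚ (x ℤ.+ y) ≡ ℤ→ℚ x + ℤ→ℚ y
  ℤ→ℚ-+ x y = ℚP.toℚᵘ-injective (ℚᵘP.≃-trans (ℚᵘP.≃-reflexive (ℤ→ℚ-toℚᵘ (x ℤ.+ y)))
    (ℚᵘP.≃-trans (ℚᵘ.*≡* same-cross-product)
      (ℚᵘP.≃-sym (ℚᵘP.≃-trans (ℚP.toℚᵘ-homo-+ (ℤ→ℚ x) (ℤ→ℚ y))
        (ℚᵘP.≃-reflexive (cong₂ ℚᵘ._+_ (ℤ→ℚ-toℚᵘ x) (ℤ→ℚ-toℚᵘ y)))))))
    where
    same-cross-product : (x ℤ.+ y) ℤ.* + 1 ≡ (x ℤ.* + 1 ℤ.+ y ℤ.* + 1) ℤ.* + 1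
    same-cross-product =
      cong (ℤ._* + 1) (sym (cong₂ ℤ._+_ (ℤP.*-identityʳ x) (ℤP.*-identityʳ y)))

  ℤ→ℚ-* : ∀ x y → ℤ→ℚ (x ℤ.* y) ≡ ℤ→ℚ x * ℤ→ℚ y
  ℤ→ℚ-* x y = ℚP.toℚᵘ-injective (ℚᵘP.≃-trans (ℚᵘP.≃-reflexive (ℤ→ℚ-toℚᵘ (x ℤ.* y)))
    (ℚᵘP.≃-trans (ℚᵘ.*≡* refl)
      (ℚᵘP.≃-sym (ℚᵘP.≃-trans (ℚP.toℚᵘ-homo-* (ℤ→ℚ x) (ℤ→ℚ y))
        (ℚᵘP.≃-reflexive (cong₂ ℚᵘ._*_ (ℤ→ℚ-toℚᵘ x) (ℤ→ℚ-toℚᵘ y)))))))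

  ℤ→ℚ-≢0 : ∀ z → z ≢ + 0 → ℤ→ℚ z ≢ 0ℚ
  ℤ→ℚ-≢0 z z≢0 e = z≢0 (injective (trans (sym (ℤ→ℚ-toℚᵘ z)) (trans (cong ℚ.toℚᵘ e) (ℤ→ℚ-toℚᵘ (+ 0)))))
    where
    injective : ∀ {x y} → ℚᵘ.mkℚᵘ x 0 ≡ ℚᵘ.mkℚᵘ y 0 → x ≡ y
    injective refl = refl

  ℕ→ℤ→ℚ-≢0 : ∀ {x : ℕ} → 0 ℕ.< x → ℤ→ℚ (+ x) ≢ 0ℚ
  ℕ→ℤ→ℚ-≢0 {suc x} _ = ℤ→ℚ-≢0 (+ suc x) (λ ())

  -- For a graph count: if S + X = D N (S the "excluded" part of D N),
  -- then D N (1 − S / (D N)) = X, written with the factors as in B(i,j,·).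
  complement-scaled : ∀ (D : ℤ) (N S X : ℕ) → + (S ℕ.+ X) ≡ D ℤ.* + N →
    ℤ→ℚ D * ℤ→ℚ (+ N) * (1ℚ - (1ℚ ÷₀ ℤ→ℚ D) * (ℤ→ℚ (+ S) ÷₀ ℤ→ℚ (+ N))) ≡ ℤ→ℚ (+ X)
  complement-scaled D zero S X S+X≡DN
    rewrite ℕP.m+n≡0⇒n≡0 S (ℤP.+-injective (trans S+X≡DN (ℤP.*-zeroʳ D))) =
    trans (cong (_* rest) (ℚP.*-zeroʳ (ℤ→ℚ D))) (ℚP.*-zeroˡ rest)
    where rest = 1ℚ - (1ℚ ÷₀ ℤ→ℚ D) * (ℤ→ℚ (+ S) ÷₀ ℤ→ℚ (+ 0))
  complement-scaled D N@(suc _) S X S+X≡DN with D ℤ.≟ + 0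
  ... | yes refl rewrite ℕP.m+n≡0⇒n≡0 S (ℤP.+-injective S+X≡DN) =
    trans (cong (_* rest) (ℚP.*-zeroˡ (ℤ→ℚ (+ N)))) (ℚP.*-zeroˡ rest)
    where rest = 1ℚ - (1ℚ ÷₀ ℤ→ℚ (+ 0)) * (ℤ→ℚ (+ S) ÷₀ ℤ→ℚ (+ N))
  ... | no D≢0 = begin
      ℤ→ℚ D * ℤ→ℚ (+ N) * (1ℚ - u * s)
    ≡⟨ expand (ℤ→ℚ D) (ℤ→ℚ (+ N)) u s ⟩
      ℤ→ℚ D * ℤ→ℚ (+ N) - (u * ℤ→ℚ D) * (s * ℤ→ℚ (+ N))
    ≡⟨ cong₂ (λ p q → ℤ→ℚ D * ℤ→ℚ (+ N) - p * q)
         (÷₀-*-inverse (ℤ→ℚ-≢0 D D≢0)) (÷₀-*-inverse (ℤ→ℚ-≢0 (+ N) (λ ()))) ⟩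
      ℤ→ℚ D * ℤ→ℚ (+ N) - 1ℚ * ℤ→ℚ (+ S)
    ≡⟨ cong₂ _-_ (trans (sym (ℤ→ℚ-* D (+ N))) (cong ℤ→ℚ (sym S+X≡DN))) (ℚP.*-identityˡ _) ⟩
      ℤ→ℚ (+ (S ℕ.+ X)) - ℤ→ℚ (+ S)
    ≡⟨ cong (_- ℤ→ℚ (+ S)) (trans (cong ℤ→ℚ (ℤP.pos-+ S X)) (ℤ→ℚ-+ (+ S) (+ X))) ⟩
      (ℤ→ℚ (+ S) + ℤ→ℚ (+ X)) - ℤ→ℚ (+ S)
    ≡⟨ cancel (ℤ→ℚ (+ S)) (ℤ→ℚ (+ X)) ⟩
      ℤ→ℚ (+ X) ∎
    where
    u = 1ℚ ÷₀ ℤ→ℚ D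
    s = ℤ→ℚ (+ S) ÷₀ ℤ→ℚ (+ N)
    expand : ∀ D N u s → D * N * (1ℚ - u * s) ≡ D * N - (u * D) * (s * N)
    expand = solve 4 (λ D N u s → D :* N :* (con 1ℚ :- u :* s) := D :* N :- (u :* D) :* (s :* N)) refl
    cancel : ∀ s x → (s + x) - s ≡ x
    cancel = solve 2 (λ s x → (s :+ x) :- s := x) refl

  -- Part (b) is this rearrangement of the balance d_a N₁ x = d_b N₂ y.
  ratio-from-balance : ∀ {N₁ N₂ da db x y : ℚ} → N₁ ≢ 0ℚ → db ≢ 0ℚ → y ≢ 0ℚ →
    da * N₁ * x ≡ db * N₂ * y → N₂ ÷₀ N₁ ≡ (da ÷₀ db) * (x ÷₀ y)
  ratio-from-balance {N₁} {N₂} {da} {db} {x} {y} N₁≢0 db≢0 y≢0 balance =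
    ÷₀-unique N₁≢0 (*-cancelʳ (*-≢0 db≢0 y≢0) (begin
      N₂ * (db * y)                    ≡⟨ solve 3 (λ N₂ db y → N₂ :* (db :* y) := db :* N₂ :* y) refl N₂ db y ⟩
      db * N₂ * y                      ≡⟨ sym balance ⟩
      da * N₁ * x                      ≡⟨ solve 3 (λ da x N₁ → da :* N₁ :* x := da :* x :* N₁) refl da x N₁ ⟩
      da * x * N₁                      ≡⟨ cong₂ (λ p q → p * q * N₁) (sym (÷₀-*-inverse db≢0)) (sym (÷₀-*-inverse y≢0)) ⟩
      (s * db) * (t * y) * N₁          ≡⟨ solve 5 (λ s t N₁ db y → (s :* db) :* (t :* y) :* N₁ := ((s :* t) :* N₁) :* (db :* y)) refl s t N₁ db y ⟩
      ((s * t) * N₁) * (db * y) ∎))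
    where
    s = da ÷₀ db
    t = x ÷₀ y

  -- Each summand in part (a) is a quotient of quotients that cancels.
  quotient-of-ratios : ∀ {Mb Ma X Y : ℚ} → Ma ≢ 0ℚ → Mb ≢ 0ℚ → Y ≢ 0ℚ →
    (Mb ÷₀ Ma) * ((X ÷₀ Mb) ÷₀ (Y ÷₀ Ma)) ≡ X ÷₀ Y
  quotient-of-ratios {Mb} {Ma} {X} {Y} Ma≢0 Mb≢0 Y≢0 = sym (÷₀-unique Y≢0 (begin
      X                     ≡⟨ sym (÷₀-*-inverse Mb≢0) ⟩
      u * Mb                ≡⟨ cong₂ _*_ (sym (÷₀-*-inverse (÷₀-≢0 Y≢0 Ma≢0))) (sym (÷₀-*-inverse Ma≢0)) ⟩
      (z * y) * (s * Ma)    ≡⟨ solve 4 (λ z y s Ma → (z :* y) :* (s :* Ma) := (s :* z) :* (y :* Ma)) refl z y s Ma ⟩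
      (s * z) * (y * Ma)    ≡⟨ cong ((s * z) *_) (÷₀-*-inverse Ma≢0) ⟩
      (s * z) * Y ∎))
    where
    s = Mb ÷₀ Ma
    u = X ÷₀ Mb
    y = Y ÷₀ Ma
    z = u ÷₀ y

  complement-fraction : ∀ (N Q M : ℕ) → N ℕ.+ Q ≡ M → ℤ→ℚ (+ M) ≢ 0ℚ →
    1ℚ - ℤ→ℚ (+ Q) ÷₀ ℤ→ℚ (+ M) ≡ ℤ→ℚ (+ N) ÷₀ ℤ→ℚ (+ M)
  complement-fraction N Q M N+Q≡M M≢0 = sym (÷₀-unique M≢0 (sym (begin
      (1ℚ - ℤ→ℚ (+ Q) ÷₀ ℤ→ℚ (+ M)) * ℤ→ℚ (+ M)
    ≡⟨ solve 2 (λ q M → (con 1ℚ :- q) :* M := M :- q :* M) refl (ℤ→ℚ (+ Q) ÷₀ ℤ→ℚ (+ M)) (ℤ→ℚ (+ M)) ⟩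
      ℤ→ℚ (+ M) - (ℤ→ℚ (+ Q) ÷₀ ℤ→ℚ (+ M)) * ℤ→ℚ (+ M)
    ≡⟨ cong₂ _-_ (cong (λ z → ℤ→ℚ (+ z)) (sym N+Q≡M)) (÷₀-*-inverse M≢0) ⟩
      ℤ→ℚ (+ (N ℕ.+ Q)) - ℤ→ℚ (+ Q)
    ≡⟨ cong (_- ℤ→ℚ (+ Q)) (trans (cong ℤ→ℚ (ℤP.pos-+ N Q)) (ℤ→ℚ-+ (+ N) (+ Q))) ⟩
      (ℤ→ℚ (+ N) + ℤ→ℚ (+ Q)) - ℤ→ℚ (+ Q)
    ≡⟨ solve 2 (λ x y → (x :+ y) :- y := x) refl (ℤ→ℚ (+ N)) (ℤ→ℚ (+ Q)) ⟩
      ℤ→ℚ (+ N) ∎)))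

  -- Part (a) is stated as p = d · (1 / S); this rewrites Na/N into that shape.
  quotient-as-reciprocal : ∀ {Na N dv : ℚ} → Na ≢ 0ℚ → N ≢ 0ℚ → dv ≢ 0ℚ →
    Na ÷₀ N ≡ dv * (1ℚ ÷₀ ((dv * N) ÷₀ Na))
  quotient-as-reciprocal {Na} {N} {dv} Na≢0 N≢0 dv≢0 = ÷₀-unique N≢0 (begin
      Na              ≡⟨ sym (ℚP.*-identityˡ Na) ⟩
      1ℚ * Na         ≡⟨ cong (_* Na) (sym (÷₀-*-inverse y≢0)) ⟩
      (z * y) * Na    ≡⟨ ℚP.*-assoc z y Na ⟩
      z * (y * Na)    ≡⟨ cong (z *_) (÷₀-*-inverse Na≢0) ⟩
      z * (dv * N)    ≡⟨ solve 3 (λ z dv N → z :* (dv :* N) := (dv :* z) :* N) refl z dv N ⟩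
      (dv * z) * N ∎)
    where
    y = (dv * N) ÷₀ Na
    z = 1ℚ ÷₀ y
    y≢0 : y ≢ 0ℚ
    y≢0 = ÷₀-≢0 (*-≢0 dv≢0 N≢0) Na≢0

module Counting where

  open import Data.Nat using (_+_; _*_; _≤_; _<_)
  open import Data.Nat.Tactic.RingSolver using (solve-∀)

  𝟙 : Bool → ℕ
  𝟙 true = 1
  𝟙 false = 0

  sumL : {X : Set} → (X → ℕ) → List X → ℕ
  sumL f [] = 0
  sumL f (x ∷ xs) = f x + sumL f xs

  count : {X : Set} → (X → Bool) → List X → ℕ
  count q = sumL (λ x → 𝟙 (q x))

  sumL-++ : ∀ {X : Set} (f : X → ℕ) xs ys → sumL f (xs ++ ys) ≡ sumL f xs + sumL f ys
  sumL-++ f [] ys = refl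
  sumL-++ f (x ∷ xs) ys = trans (cong (f x +_) (sumL-++ f xs ys)) (sym (ℕP.+-assoc (f x) _ _))

  sumL-concat : ∀ {X : Set} (f : X → ℕ) (xss : List (List X)) → sumL f (concat xss) ≡ sumL (sumL f) xss
  sumL-concat f [] = refl
  sumL-concat f (xs ∷ xss) = trans (sumL-++ f xs (concat xss)) (cong (sumL f xs +_) (sumL-concat f xss))

  sumL-map : ∀ {X Y : Set} (f : Y → ℕ) (g : X → Y) xs → sumL f (map g xs) ≡ sumL (λ x → f (g x)) xs
  sumL-map f g [] = refl
  sumL-map f g (x ∷ xs) = cong (f (g x) +_) (sumL-map f g xs)

  sumL-cong : ∀ {X : Set} {f g : X → ℕ} → (∀ x → f x ≡ g x) → ∀ xs → sumL f xs ≡ sumL g xs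
  sumL-cong e [] = refl
  sumL-cong e (x ∷ xs) = cong₂ _+_ (e x) (sumL-cong e xs)

  sumL-cong-All : ∀ {X : Set} {Q : X → Set} {f g : X → ℕ} →
    (∀ x → Q x → f x ≡ g x) → ∀ {xs} → All Q xs → sumL f xs ≡ sumL g xs
  sumL-cong-All h [] = refl
  sumL-cong-All h (q ∷ qs) = cong₂ _+_ (h _ q) (sumL-cong-All h qs)

  sumL-+ : ∀ {X : Set} (f g : X → ℕ) xs → sumL (λ x → f x + g x) xs ≡ sumL f xs + sumL g xs
  sumL-+ f g [] = refl
  sumL-+ f g (x ∷ xs) =
    trans (cong ((f x + g x) +_) (sumL-+ f g xs)) (interchange (f x) (g x) _ _)
    where
    interchange : ∀ a b c d → (a + b) + (c + d) ≡ (a + c) + (b + d)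
    interchange = solve-∀

  sumL-zero : ∀ {X : Set} (xs : List X) → sumL (λ _ → 0) xs ≡ 0
  sumL-zero [] = refl
  sumL-zero (x ∷ xs) = sumL-zero xs

  count-zero : ∀ {X : Set} (q : X → Bool) → (∀ x → q x ≡ false) → ∀ xs → count q xs ≡ 0
  count-zero q h xs = trans (sumL-cong (λ x → cong 𝟙 (h x)) xs) (sumL-zero xs)

  sumL-swap : ∀ {X Y : Set} (f : X → Y → ℕ) xs ys →
    sumL (λ x → sumL (f x) ys) xs ≡ sumL (λ y → sumL (λ x → f x y) xs) ys
  sumL-swap f [] ys = sym (sumL-zero ys)
  sumL-swap f (x ∷ xs) ys = trans (cong (sumL (f x) ys +_) (sumL-swap f xs ys))
    (sym (sumL-+ (f x) (λ y → sumL (λ x → f x y) xs) ys))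

  sumL-*ˡ : ∀ {X : Set} c (f : X → ℕ) xs → c * sumL f xs ≡ sumL (λ x → c * f x) xs
  sumL-*ˡ c f [] = ℕP.*-zeroʳ c
  sumL-*ˡ c f (x ∷ xs) = trans (ℕP.*-distribˡ-+ c (f x) _) (cong (c * f x +_) (sumL-*ˡ c f xs))

  sumL-mono : ∀ {X : Set} {f g : X → ℕ} → (∀ x → f x ≤ g x) → ∀ xs → sumL f xs ≤ sumL g xs
  sumL-mono e [] = z≤n
  sumL-mono e (x ∷ xs) = ℕP.+-mono-≤ (e x) (sumL-mono e xs)

  sumL-allFin-≥ : ∀ n (f : Fin n → ℕ) i → f i ≤ sumL f (allFin n)
  sumL-allFin-≥ (suc n) f Fin.zero = ℕP.m≤m+n (f Fin.zero) _
  sumL-allFin-≥ (suc n) f (Fin.suc i) = ℕP.≤-trans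
    (subst (f (Fin.suc i) ≤_)
       (sym (trans (cong (sumL f) (sym (ListP.map-tabulate {n = n} (λ j → j) Fin.suc)))
                   (sumL-map f Fin.suc (allFin n))))
       (sumL-allFin-≥ n (λ j → f (Fin.suc j)) i))
    (ℕP.m≤n+m _ (f Fin.zero))

  length-filter : ∀ {X : Set} {P : X → Set} (P? : U.Decidable P) xs →
    length (filter P? xs) ≡ count (λ x → does (P? x)) xs
  length-filter P? [] = refl
  length-filter P? (x ∷ xs) with does (P? x)
  ... | true = cong suc (length-filter P? xs)
  ... | false = length-filter P? xs

  sumL-filter : ∀ {X : Set} {P : X → Set} (P? : U.Decidable P) (f : X → ℕ) xs →
    sumL f (filter P? xs) ≡ sumL (λ x → 𝟙 (does (P? x)) * f x) xs
  sumL-filter P? f [] = refl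
  sumL-filter P? f (x ∷ xs) with does (P? x)
  ... | true = cong₂ _+_ (sym (ℕP.+-identityʳ (f x))) (sumL-filter P? f xs)
  ... | false = sumL-filter P? f xs

  sumL-filter-vanishing : ∀ {X : Set} {P : X → Set} (P? : U.Decidable P) (f : X → ℕ) →
    (∀ x → ¬ P x → f x ≡ 0) → ∀ xs → sumL f (filter P? xs) ≡ sumL f xs
  sumL-filter-vanishing P? f h [] = refl
  sumL-filter-vanishing P? f h (x ∷ xs) with P? x
  ... | yes _ = cong (f x +_) (sumL-filter-vanishing P? f h xs)
  ... | no ¬Px = trans (sumL-filter-vanishing P? f h xs) (cong (_+ sumL f xs) (sym (h x ¬Px)))

  disjoint-∨ : ∀ p q → p ∧ q ≡ false → 𝟙 (p ∨ q) ≡ 𝟙 p + 𝟙 q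
  disjoint-∨ true true ()
  disjoint-∨ true false _ = refl
  disjoint-∨ false true _ = refl
  disjoint-∨ false false _ = refl

  count-cong : ∀ {X : Set} {p q : X → Bool} → (∀ x → p x ≡ q x) → ∀ xs → count p xs ≡ count q xs
  count-cong e = sumL-cong (λ x → cong 𝟙 (e x))

  does-≟true : (b : Bool) → does (b Bool.≟ true) ≡ b
  does-≟true true = refl
  does-≟true false = refl

  does-sound : ∀ {Q : Set} (q? : Dec Q) → does q? ≡ true → Q
  does-sound (yes q) _ = q

  isPos : ℕ → Bool
  isPos zero = false
  isPos (suc _) = true

  any-count : ∀ {X : Set} (q : X → Bool) xs → any q xs ≡ isPos (count q xs)
  any-count q [] = refl
  any-count q (x ∷ xs) with q x
  ... | true = refl
  ... | false = any-count q xs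

  all-count : ∀ {X : Set} (q : X → Bool) xs → all q xs ≡ not (isPos (count (λ x → not (q x)) xs))
  all-count q [] = refl
  all-count q (x ∷ xs) with q x
  ... | true = all-count q xs
  ... | false = refl

  count-witness : ∀ {X : Set} (q : X → Bool) xs → 0 < count q xs → Σ X (λ x → q x ≡ true)
  count-witness q (x ∷ xs) h with q x in eq
  ... | true = x , eq
  ... | false = count-witness q xs h

  all-cong : ∀ {X : Set} {p q : X → Bool} → (∀ x → p x ≡ q x) → ∀ xs → all p xs ≡ all q xs
  all-cong e [] = refl
  all-cong e (x ∷ xs) = cong₂ _∧_ (e x) (all-cong e xs)

  any-cong : ∀ {X : Set} {p q : X → Bool} → (∀ x → p x ≡ q x) → ∀ xs → any p xs ≡ any q xs
  any-cong e [] = refl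
  any-cong e (x ∷ xs) = cong₂ _∨_ (e x) (any-cong e xs)

  ∧-elim : ∀ {x y} → x ∧ y ≡ true → x ≡ true × y ≡ true
  ∧-elim {true} {true} _ = refl , refl

  all-allFin : ∀ {n} (p : Fin n → Bool) → all p (allFin n) ≡ true → ∀ i → p i ≡ true
  all-allFin p h i = all-tabulate p (λ j → j) h i
    where
    all-tabulate : ∀ {X : Set} {n} (p : X → Bool) (f : Fin n → X) →
      all p (tabulate f) ≡ true → ∀ i → p (f i) ≡ true
    all-tabulate {n = suc n} p f h Fin.zero = proj₁ (∧-elim h)
    all-tabulate {n = suc n} p f h (Fin.suc i) =
      all-tabulate p (λ j → f (Fin.suc j)) (proj₂ (∧-elim h)) i

  any-all : ∀ {X : Set} (q r : X → Bool) xs → any q xs ≡ true → all r xs ≡ true →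
    Σ X (λ x → q x ≡ true × r x ≡ true)
  any-all q r (x ∷ xs) h₁ h₂ with q x in eq | ∧-elim {r x} h₂
  ... | true | (rx , _) = x , eq , rx
  ... | false | (_ , rest) = any-all q r xs h₁ rest

  nth : ∀ {X : Set} → ℕ → List X → Maybe X
  nth _ [] = nothing
  nth zero (x ∷ xs) = just x
  nth (suc k) (x ∷ xs) = nth k xs

  any-nth : ∀ {X : Set} (q : X → Bool) xs → any q xs ≡ true →
    Σ ℕ λ k → Σ X λ e → nth k xs ≡ just e × q e ≡ true
  any-nth q (x ∷ xs) h with q x in eq
  ... | true = zero , x , refl , eq
  ... | false with any-nth q xs h
  ... | k , e , at , qe = suc k , e , at , qe

  All-nth : ∀ {X : Set} {Q : X → Set} {xs} {k e} → All Q xs → nth k xs ≡ just e → Q e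
  All-nth {k = zero} (qx ∷ _) refl = qx
  All-nth {k = suc k} (_ ∷ qs) h = All-nth {k = k} qs h

module BitVectors where
  -- The sublists of a list xs are exactly the selections sel xs w by the bit
  -- vectors w of length |xs|.  Flipping one bit is an involution of these bit
  -- vectors, so counts over all bit vectors are invariant under it.

  open Counting
  open import Data.Nat using (_+_; _≤_)
  open import Data.Nat.Tactic.RingSolver using (solve-∀)

  bits : ℕ → List (List Bool)
  bits zero = [] ∷ []
  bits (suc m) = map (false ∷_) (bits m) ++ map (true ∷_) (bits m)

  sel : ∀ {X : Set} → List X → List Bool → List X
  sel [] _ = []
  sel (x ∷ xs) [] = []
  sel (x ∷ xs) (true ∷ w) = x ∷ sel xs w
  sel (x ∷ xs) (false ∷ w) = sel xs w

  flip : ℕ → List Bool → List Bool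
  flip k [] = []
  flip zero (b ∷ w) = not b ∷ w
  flip (suc k) (b ∷ w) = b ∷ flip k w

  bitAt : ℕ → List Bool → Bool
  bitAt k [] = false
  bitAt zero (b ∷ w) = b
  bitAt (suc k) (b ∷ w) = bitAt k w

  flip-length : ∀ k w → length (flip k w) ≡ length w
  flip-length k [] = refl
  flip-length zero (b ∷ w) = refl
  flip-length (suc k) (b ∷ w) = cong suc (flip-length k w)

  sublists-as-selections : ∀ {X : Set} (xs : List X) → sublists xs ≡ map (sel xs) (bits (length xs))
  sublists-as-selections [] = refl
  sublists-as-selections (x ∷ xs) = begin
      sublists xs ++ map (x ∷_) (sublists xs)
    ≡⟨ cong (λ r → r ++ map (x ∷_) r) (sublists-as-selections xs) ⟩
      map (sel xs) B ++ map (x ∷_) (map (sel xs) B)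
    ≡⟨ cong₂ _++_ (ListP.map-∘ B) (trans (sym (ListP.map-∘ B)) (ListP.map-∘ B)) ⟩
      map (sel (x ∷ xs)) (map (false ∷_) B) ++ map (sel (x ∷ xs)) (map (true ∷_) B)
    ≡⟨ sym (ListP.map-++ (sel (x ∷ xs)) (map (false ∷_) B) _) ⟩
      map (sel (x ∷ xs)) (bits (length (x ∷ xs))) ∎
    where
    B = bits (length xs)

  count-bits : ∀ m (F : List Bool → Bool) →
    count F (bits (suc m)) ≡ count (λ w → F (false ∷ w)) (bits m) + count (λ w → F (true ∷ w)) (bits m)
  count-bits m F = trans (sumL-++ _ (map (false ∷_) (bits m)) _)
    (cong₂ _+_ (sumL-map _ (false ∷_) (bits m)) (sumL-map _ (true ∷_) (bits m)))

  -- Flipping bit k is a bijection of bits m, so it preserves every count.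
  count-flip-invariant : ∀ m k (F : List Bool → Bool) → count (λ w → F (flip k w)) (bits m) ≡ count F (bits m)
  count-flip-invariant zero k F = refl
  count-flip-invariant (suc m) zero F = trans (count-bits m (λ w → F (flip zero w)))
    (trans (ℕP.+-comm (count (λ w → F (true ∷ w)) (bits m)) _) (sym (count-bits m F)))
  count-flip-invariant (suc m) (suc k) F = trans (count-bits m (λ w → F (flip (suc k) w)))
    (trans (cong₂ _+_ (count-flip-invariant m k (λ w → F (false ∷ w)))
                      (count-flip-invariant m k (λ w → F (true ∷ w))))
      (sym (count-bits m F)))

  count-cong-bits : ∀ m {F G : List Bool → Bool} → (∀ w → length w ≡ m → F w ≡ G w) →
    count F (bits m) ≡ count G (bits m)
  count-cong-bits zero h = cong (λ z → 𝟙 z + 0) (h [] refl)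
  count-cong-bits (suc m) {F} {G} h = trans (count-bits m F) (trans
    (cong₂ _+_ (count-cong-bits m (λ w e → h (false ∷ w) (cong suc e)))
               (count-cong-bits m (λ w e → h (true ∷ w) (cong suc e))))
    (sym (count-bits m G)))

  count-sel-flip : ∀ {X : Set} (q : X → Bool) xs w k {e} → nth k xs ≡ just e → length w ≡ length xs →
    count q (sel xs (flip k w)) + 𝟙 (bitAt k w ∧ q e) ≡ count q (sel xs w) + 𝟙 (not (bitAt k w) ∧ q e)
  count-sel-flip q (x ∷ xs) (true ∷ w) zero refl _ = swap (𝟙 (q x)) (count q (sel xs w))
    where
    swap : ∀ a c → c + a ≡ (a + c) + 0
    swap = solve-∀
  count-sel-flip q (x ∷ xs) (false ∷ w) zero refl _ = swap (𝟙 (q x)) (count q (sel xs w))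
    where
    swap : ∀ a c → (a + c) + 0 ≡ c + a
    swap = solve-∀
  count-sel-flip q (x ∷ xs) (true ∷ w) (suc k) at len =
    trans (ℕP.+-assoc (𝟙 (q x)) _ _)
      (trans (cong (𝟙 (q x) +_) (count-sel-flip q xs w k at (ℕP.suc-injective len)))
        (sym (ℕP.+-assoc (𝟙 (q x)) _ _)))
  count-sel-flip q (x ∷ xs) (false ∷ w) (suc k) at len = count-sel-flip q xs w k at (ℕP.suc-injective len)

  count-sel-≤ : ∀ {X : Set} (q : X → Bool) xs w → count q (sel xs w) ≤ count q xs
  count-sel-≤ q [] w = z≤n
  count-sel-≤ q (x ∷ xs) [] = z≤n
  count-sel-≤ q (x ∷ xs) (true ∷ w) = ℕP.+-monoʳ-≤ (𝟙 (q x)) (count-sel-≤ q xs w)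
  count-sel-≤ q (x ∷ xs) (false ∷ w) = ℕP.≤-trans (count-sel-≤ q xs w) (ℕP.m≤n+m _ (𝟙 (q x)))

  All-sel : ∀ {X : Set} {Q : X → Set} {xs} w → All Q xs → All Q (sel xs w)
  All-sel w [] = []
  All-sel [] (_ ∷ _) = []
  All-sel (true ∷ w) (qx ∷ qs) = qx ∷ All-sel w qs
  All-sel (false ∷ w) (qx ∷ qs) = All-sel w qs

module FinPairs where

  open Counting
  open import Data.Nat using (_+_; _*_)

  ==-sound : ∀ {n} {x y : Fin n} → (x == y) ≡ true → x ≡ y
  ==-sound {x = x} {y} = does-sound (x Fin.≟ y)

  ==-refl : ∀ {n} (x : Fin n) → (x == x) ≡ true
  ==-refl x = dec-true (x Fin.≟ x) refl

  ==-false : ∀ {n} {x y : Fin n} → x ≢ y → (x == y) ≡ false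
  ==-false {x = x} {y} x≢y = dec-false (x Fin.≟ y) x≢y

  ==-sym : ∀ {n} (x y : Fin n) → (x == y) ≡ (y == x)
  ==-sym x y with x Fin.≟ y
  ... | yes refl = sym (==-refl x)
  ... | no x≢y = sym (==-false (λ y≡x → x≢y (sym y≡x)))

  <ᵇ-irrefl : ∀ {n} (i : Fin n) → (i <ᵇ i) ≡ false
  <ᵇ-irrefl i = dec-false (i Fin.<? i) (FinP.<-irrefl refl)

  <ᵇ-asym : ∀ {n} (i j : Fin n) → (i <ᵇ j) ≡ true → (j <ᵇ i) ≡ false
  <ᵇ-asym i j h = dec-false (j Fin.<? i) (FinP.<-asym (does-sound (i Fin.<? j) h))

  count-allFin-== : ∀ n (v : Fin n) → count (λ j → j == v) (allFin n) ≡ 1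
  count-allFin-== (suc n) v = trans
    (cong (λ js → 𝟙 (Fin.zero == v) + count (λ j → j == v) js)
          (sym (ListP.map-tabulate {n = n} (λ j → j) Fin.suc)))
    (trans (cong (𝟙 (Fin.zero == v) +_) (sumL-map (λ j → 𝟙 (j == v)) Fin.suc (allFin n))) (at v))
    where
    at : ∀ v → 𝟙 (Fin.zero == v) + count (λ j → Fin.suc j == v) (allFin n) ≡ 1
    at Fin.zero = cong suc (count-zero _ (λ _ → refl) (allFin n))
    at (Fin.suc v) = count-allFin-== n v

  count-select : ∀ n (v : Fin n) (g : Fin n → Bool) → count (λ j → (j == v) ∧ g j) (allFin n) ≡ 𝟙 (g v)
  count-select n v g = begin
      count (λ j → (j == v) ∧ g j) (allFin n)
    ≡⟨ sumL-cong (λ j → split j) (allFin n) ⟩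
      sumL (λ j → 𝟙 (g v) * 𝟙 (j == v)) (allFin n)
    ≡⟨ sym (sumL-*ˡ (𝟙 (g v)) (λ j → 𝟙 (j == v)) (allFin n)) ⟩
      𝟙 (g v) * count (λ j → j == v) (allFin n)
    ≡⟨ cong (𝟙 (g v) *_) (count-allFin-== n v) ⟩
      𝟙 (g v) * 1
    ≡⟨ ℕP.*-identityʳ _ ⟩
      𝟙 (g v) ∎
    where
    split : ∀ j → 𝟙 ((j == v) ∧ g j) ≡ 𝟙 (g v) * 𝟙 (j == v)
    split j with j Fin.≟ v
    ... | yes refl = sym (ℕP.*-identityʳ (𝟙 (g j)))
    ... | no _ = sym (ℕP.*-zeroʳ (𝟙 (g v)))

  Pair : ℕ → Set
  Pair n = Fin n × Fin n

  count-pairs : ∀ n (q : Pair n → Bool) →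
    count q (pairs n) ≡ sumL (λ i → sumL (λ j → 𝟙 (i <ᵇ j) * 𝟙 (q (i , j))) (allFin n)) (allFin n)
  count-pairs n q = trans (sumL-concat _ (map row (allFin n)))
    (trans (sumL-map (count q) row (allFin n))
      (sumL-cong (λ i → trans (sumL-map (λ e → 𝟙 (q e)) (λ j → (i , j)) (filter (λ j → i Fin.<? j) (allFin n)))
                              (sumL-filter (λ j → i Fin.<? j) (λ j → 𝟙 (q (i , j))) (allFin n))) (allFin n)))
    where
    row : Fin n → List (Pair n)
    row i = map (λ j → (i , j)) (filter (λ j → i Fin.<? j) (allFin n))

  Ordered : ∀ {n} → Pair n → Set
  Ordered (i , j) = i Fin.< j

  pairs-ordered : ∀ n → All Ordered (pairs n)
  pairs-ordered n = AllP.concat⁺ (AllP.map⁺ (AllP.tabulate⁺ (λ i →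
    AllP.map⁺ (AllP.all-filter (λ j → i Fin.<? j) (allFin n)))))

  Ordered⇒≢ : ∀ {n} {x y : Fin n} → x Fin.< y → x ≢ y
  Ordered⇒≢ x<y refl = FinP.<-irrefl refl x<y

  ordered-ends-distinct : ∀ {n} {x y : Fin n} → x Fin.< y → ∀ i → (x == i) ∧ (y == i) ≡ false
  ordered-ends-distinct {x = x} {y} x<y i with x == i in e₁ | y == i in e₂
  ... | true | true = ⊥-elim (Ordered⇒≢ x<y (trans (==-sound e₁) (sym (==-sound e₂))))
  ... | true | false = refl
  ... | false | _ = refl

  joins : ∀ {n} → Fin n → Fin n → Pair n → Bool
  joins u v (i , j) = ((i == u) ∧ (j == v)) ∨ ((i == v) ∧ (j == u))

  joins-sound : ∀ {n} {u v x y : Fin n} → joins u v (x , y) ≡ true → (x ≡ u × y ≡ v) ⊎ (x ≡ v × y ≡ u)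
  joins-sound {u = u} {v} {x} {y} h with (x == u) ∧ (y == v) in e
  ... | true = inj₁ (==-sound (proj₁ (∧-elim e)) , ==-sound (proj₂ (∧-elim e)))
  ... | false = inj₂ (==-sound (proj₁ (∧-elim h)) , ==-sound (proj₂ (∧-elim h)))

  count-pairs-joining : ∀ n (u v : Fin n) → count (joins u v) (pairs n) ≡ 𝟙 (u <ᵇ v) + 𝟙 (v <ᵇ u)
  count-pairs-joining n u v = begin
      count (joins u v) (pairs n)
    ≡⟨ count-pairs n (joins u v) ⟩
      sumL (λ i → sumL (λ j → 𝟙 (i <ᵇ j) * 𝟙 (joins u v (i , j))) (allFin n)) (allFin n)
    ≡⟨ sumL-cong (λ i → trans (sumL-cong (λ j → split (i <ᵇ j) _ _ (not-both i j)) (allFin n))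
                              (sumL-+ _ _ (allFin n))) (allFin n) ⟩
      sumL (λ i → sumL (λ j → 𝟙 ((i <ᵇ j) ∧ ((i == u) ∧ (j == v)))) (allFin n)
                + sumL (λ j → 𝟙 ((i <ᵇ j) ∧ ((i == v) ∧ (j == u)))) (allFin n)) (allFin n)
    ≡⟨ sumL-+ _ _ (allFin n) ⟩
      sumL (λ i → sumL (λ j → 𝟙 ((i <ᵇ j) ∧ ((i == u) ∧ (j == v)))) (allFin n)) (allFin n)
      + sumL (λ i → sumL (λ j → 𝟙 ((i <ᵇ j) ∧ ((i == v) ∧ (j == u)))) (allFin n)) (allFin n)
    ≡⟨ cong₂ _+_ (oriented u v) (oriented v u) ⟩
      𝟙 (u <ᵇ v) + 𝟙 (v <ᵇ u) ∎
    where
    split : ∀ a x y → a ∧ (x ∧ y) ≡ false → 𝟙 a * 𝟙 (x ∨ y) ≡ 𝟙 (a ∧ x) + 𝟙 (a ∧ y)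
    split true true true ()
    split true true false _ = refl
    split true false true _ = refl
    split true false false _ = refl
    split false x y _ = refl
    not-both : ∀ i j → (i <ᵇ j) ∧ (((i == u) ∧ (j == v)) ∧ ((i == v) ∧ (j == u))) ≡ false
    not-both i j with i == u in e₁ | j == v in e₂ | i == v in e₃
    ... | true | true | true = cong (_∧ (j == u)) (trans (cong (i <ᵇ_) j≡i) (<ᵇ-irrefl i))
      where
      j≡i : j ≡ i
      j≡i = trans (==-sound e₂) (sym (==-sound e₃))
    ... | true | true | false = BoolP.∧-zeroʳ _
    ... | true | false | _ = BoolP.∧-zeroʳ _
    ... | false | _ | _ = BoolP.∧-zeroʳ _
    reorder : ∀ a x y → 𝟙 (a ∧ (x ∧ y)) ≡ 𝟙 (y ∧ (x ∧ a))
    reorder true true true = refl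
    reorder true true false = refl
    reorder true false y = cong 𝟙 (sym (BoolP.∧-zeroʳ y))
    reorder false x y = cong 𝟙 (sym (trans (cong (y ∧_) (BoolP.∧-zeroʳ x)) (BoolP.∧-zeroʳ y)))
    oriented : ∀ u v → sumL (λ i → sumL (λ j → 𝟙 ((i <ᵇ j) ∧ ((i == u) ∧ (j == v)))) (allFin n)) (allFin n) ≡ 𝟙 (u <ᵇ v)
    oriented u v = trans
      (sumL-cong (λ i → trans (sumL-cong (λ j → reorder (i <ᵇ j) (i == u) (j == v)) (allFin n))
                              (count-select n v (λ j → (i == u) ∧ (i <ᵇ j)))) (allFin n))
      (count-select n u (λ i → i <ᵇ v))

module UnitVectors where

  open Counting
  open FinPairs
  open import Data.Integer using (+_)

  add-sub : ∀ x δ → (x ℤ.+ δ) ℤ.- δ ≡ x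
  add-sub = ℤSolver.solve-∀

  sub-add : ∀ x δ → (x ℤ.- δ) ℤ.+ δ ≡ x
  sub-add = ℤSolver.solve-∀

  -e-val : ∀ {n} (d : Fin n → ℤ) a i → (d -e a) i ≡ d i ℤ.- + 𝟙 (i == a)
  -e-val d a i with i == a
  ... | true = refl
  ... | false = sym (ℤP.+-identityʳ (d i))

  -e-self : ∀ {n} (d : Fin n → ℤ) i → (d -e i) i ℤ.+ + 1 ≡ d i
  -e-self d i = trans (cong (ℤ._+ + 1) (trans (-e-val d i i) (cong (λ z → d i ℤ.- + 𝟙 z) (==-refl i))))
    (sub-add (d i) (+ 1))

  -e-other : ∀ {n} (d : Fin n → ℤ) {x y} → x ≢ y → (d -e y) x ≡ d x
  -e-other d {x} {y} x≢y = trans (-e-val d y x) (trans (cong (λ z → d x ℤ.- + 𝟙 z) (==-false x≢y)) (ℤP.+-identityʳ (d x)))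

  -e-comm : ∀ {n} (d : Fin n → ℤ) x y i → ((d -e x) -e y) i ≡ ((d -e y) -e x) i
  -e-comm d x y i = trans (-e-val (d -e x) y i) (trans (cong (ℤ._- + 𝟙 (i == y)) (-e-val d x i))
    (trans (swap (d i) _ _) (sym (trans (-e-val (d -e y) x i) (cong (ℤ._- + 𝟙 (i == x)) (-e-val d y i))))))
    where
    swap : ∀ x y z → (x ℤ.- y) ℤ.- z ≡ (x ℤ.- z) ℤ.- y
    swap = ℤSolver.solve-∀

  -e-pair : ∀ {n} (d : Fin n → ℤ) a v i → ((d -e a) -e v) i ≡ d i ℤ.- (+ 𝟙 (i == a) ℤ.+ + 𝟙 (i == v))
  -e-pair d a v i = trans (-e-val (d -e a) v i)
    (trans (cong (ℤ._- + 𝟙 (i == v)) (-e-val d a i)) (regroup (d i) _ _))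
    where
    regroup : ∀ x p q → (x ℤ.- p) ℤ.- q ≡ x ℤ.- (p ℤ.+ q)
    regroup = ℤSolver.solve-∀

  -e-restore : ∀ {n} (d : Fin n → ℤ) a v i → (d -e a) i ℤ.+ (+ 𝟙 (i == a) ℤ.+ + 𝟙 (i == v)) ≡ d i ℤ.+ + 𝟙 (i == v)
  -e-restore d a v i = trans (cong (ℤ._+ (+ 𝟙 (i == a) ℤ.+ + 𝟙 (i == v))) (-e-val d a i)) (regroup (d i) _ _)
    where
    regroup : ∀ x p q → (x ℤ.- p) ℤ.+ (p ℤ.+ q) ≡ x ℤ.+ q
    regroup = ℤSolver.solve-∀

module GraphEncoding (n : ℕ) (A : Allowed n) where

  open Counting
  open BitVectors
  open FinPairs
  open UnitVectors using (add-sub; sub-add)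
  open import Data.Nat using (_+_; _≤_)
  open import Data.Integer using (+_)

  slots : List (Pair n)
  slots = pairs n

  m : ℕ
  m = length slots

  graph : List Bool → Graph n
  graph w = sel slots w

  edge : Fin n → Fin n → List Bool → Bool
  edge u v w = hasEdge (graph w) u v

  valid : (Fin n → ℤ) → List Bool → Bool
  valid d w = inG A d (graph w)

  touches : Fin n → Pair n → Bool
  touches i (x , y) = (x == i) ∨ (y == i)

  allowed : Pair n → Bool
  allowed (i , j) = adj A i j

  countIn : (Pair n → Bool) → List Bool → ℕ
  countIn q w = count q (graph w)

  adj-sym : ∀ i j → adj A i j ≡ adj A j i
  adj-sym i j with i <ᵇ j in i<j | j <ᵇ i in j<i
  ... | true | true with trans (sym (<ᵇ-asym i j i<j)) j<i
  ...   | ()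
  adj-sym i j | true | false = refl
  adj-sym i j | false | true = refl
  adj-sym i j | false | false = refl

  hasEdge-count : ∀ (G : Graph n) u v → hasEdge G u v ≡ isPos (count (joins u v) G)
  hasEdge-count G u v = trans (any-count _ G) (cong isPos (count-cong (λ { (i , j) → refl }) G))

  deg-count : ∀ (G : Graph n) i → deg G i ≡ count (touches i) G
  deg-count G i = trans (length-filter _ G) (count-cong (λ { (x , y) → refl }) G)

  inG-as-count : ∀ d (G : Graph n) → inG A d G ≡
    not (isPos (count (λ e → not (allowed e)) G)) ∧ all (λ i → does (+ deg G i ℤ.≟ d i)) (allFin n)
  inG-as-count d G = cong (_∧ all (λ i → does (+ deg G i ℤ.≟ d i)) (allFin n))
    (trans (all-cong (λ { (i , j) → refl }) G) (all-count allowed G))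

  -- A pair {u,v} occupies at most one slot, hence occurs at most once in a graph.
  countIn-joins-≤1 : ∀ u v w → countIn (joins u v) w ≤ 1
  countIn-joins-≤1 u v w = ℕP.≤-trans (count-sel-≤ (joins u v) slots w)
    (subst (_≤ 1) (sym (count-pairs-joining n u v)) (at-most-one (u <ᵇ v) (v <ᵇ u) (<ᵇ-asym u v)))
    where
    at-most-one : ∀ (a b : Bool) → (a ≡ true → b ≡ false) → 𝟙 a + 𝟙 b ≤ 1
    at-most-one true true h with h refl
    ... | ()
    at-most-one true false _ = s≤s z≤n
    at-most-one false true _ = s≤s z≤n
    at-most-one false false _ = z≤n

  module Toggle (k : ℕ) (e : Pair n) (at : nth k slots ≡ just e) (w : List Bool) (len : length w ≡ m) where
    bit : Bool
    bit = bitAt k w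

    w′ : List Bool
    w′ = flip k w

    countIn-flip : ∀ q → countIn q w′ + 𝟙 (bit ∧ q e) ≡ countIn q w + 𝟙 (not bit ∧ q e)
    countIn-flip q = count-sel-flip q slots w k at len

    countIn-flip-other : ∀ q → q e ≡ false → countIn q w′ ≡ countIn q w
    countIn-flip-other q qe = begin
        countIn q w′                     ≡⟨ sym (ℕP.+-identityʳ _) ⟩
        countIn q w′ + 𝟙 false           ≡⟨ cong (λ z → countIn q w′ + 𝟙 z) (sym (trans (cong (bit ∧_) qe) (BoolP.∧-zeroʳ bit))) ⟩
        countIn q w′ + 𝟙 (bit ∧ q e)     ≡⟨ countIn-flip q ⟩
        countIn q w + 𝟙 (not bit ∧ q e)  ≡⟨ cong (λ z → countIn q w + 𝟙 z) (trans (cong (not bit ∧_) qe) (BoolP.∧-zeroʳ (not bit))) ⟩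
        countIn q w + 0                  ≡⟨ ℕP.+-identityʳ _ ⟩
        countIn q w ∎

    edge-flip : ∀ u v → joins u v e ≡ true → edge u v w ≡ bit × edge u v w′ ≡ not bit
    edge-flip u v je = trans (hasEdge-count (graph w) u v) (proj₁ presence)
                     , trans (hasEdge-count (graph w′) u v) (proj₂ presence)
      where
      balance : countIn (joins u v) w′ + 𝟙 bit ≡ countIn (joins u v) w + 𝟙 (not bit)
      balance = trans (cong (λ z → countIn (joins u v) w′ + 𝟙 z) (sym (trans (cong (bit ∧_) je) (BoolP.∧-identityʳ bit))))
        (trans (countIn-flip (joins u v))
          (cong (λ z → countIn (joins u v) w + 𝟙 z) (trans (cong (not bit ∧_) je) (BoolP.∧-identityʳ (not bit)))))
      cases : ∀ c c′ → c ≤ 1 → c′ ≤ 1 → ∀ b → c′ + 𝟙 b ≡ c + 𝟙 (not b) → isPos c ≡ b × isPos c′ ≡ not b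
      cases (suc zero) zero _ _ true _ = refl , refl
      cases zero (suc zero) _ _ false _ = refl , refl
      cases zero zero _ _ true ()
      cases zero zero _ _ false ()
      cases (suc zero) (suc zero) _ _ true ()
      cases (suc zero) (suc zero) _ _ false ()
      cases zero (suc zero) _ _ true ()
      cases (suc zero) zero _ _ false ()
      cases (suc (suc c)) c′ (s≤s ()) _ b _
      cases c (suc (suc c′)) _ (s≤s ()) b _
      presence = cases (countIn (joins u v) w) (countIn (joins u v) w′)
                       (countIn-joins-≤1 u v w) (countIn-joins-≤1 u v w′) bit balance

    edge-unchanged : ∀ u v → joins u v e ≡ false → edge u v w′ ≡ edge u v w
    edge-unchanged u v je = trans (hasEdge-count (graph w′) u v)
      (trans (cong isPos (countIn-flip-other (joins u v) je)) (sym (hasEdge-count (graph w) u v)))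

    shift : Fin n → ℤ
    shift i = + 𝟙 (not bit ∧ touches i e) ℤ.- + 𝟙 (bit ∧ touches i e)

    shift-absent : bit ≡ false → ∀ i → shift i ≡ + 𝟙 (touches i e)
    shift-absent absent i rewrite absent = ℤP.+-identityʳ (+ 𝟙 (touches i e))

    shift-present : bit ≡ true → ∀ i → shift i ≡ ℤ.- (+ 𝟙 (touches i e))
    shift-present present i rewrite present = ℤP.+-identityˡ (ℤ.- (+ 𝟙 (touches i e)))

    deg-flip : ∀ i → + deg (graph w′) i ≡ + deg (graph w) i ℤ.+ shift i
    deg-flip i = begin
        + deg (graph w′) i
      ≡⟨ cong +_ (deg-count (graph w′) i) ⟩
        + countIn (touches i) w′
      ≡⟨ sym (add-sub (+ countIn (touches i) w′) (+ 𝟙 (bit ∧ touches i e))) ⟩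
        (+ countIn (touches i) w′ ℤ.+ + 𝟙 (bit ∧ touches i e)) ℤ.- + 𝟙 (bit ∧ touches i e)
      ≡⟨ cong (λ z → + z ℤ.- + 𝟙 (bit ∧ touches i e)) (countIn-flip (touches i)) ⟩
        (+ countIn (touches i) w ℤ.+ + 𝟙 (not bit ∧ touches i e)) ℤ.- + 𝟙 (bit ∧ touches i e)
      ≡⟨ ℤP.+-assoc (+ countIn (touches i) w) (+ 𝟙 (not bit ∧ touches i e)) (ℤ.- + 𝟙 (bit ∧ touches i e)) ⟩
        + countIn (touches i) w ℤ.+ shift i
      ≡⟨ cong (λ z → + z ℤ.+ shift i) (sym (deg-count (graph w) i)) ⟩
        + deg (graph w) i ℤ.+ shift i ∎

    valid-flip : ∀ (d d′ : Fin n → ℤ) → allowed e ≡ true → (∀ i → d′ i ≡ d i ℤ.- shift i) → valid d w′ ≡ valid d′ w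
    valid-flip d d′ ae d′-eq = trans (inG-as-count d (graph w′)) (trans (cong₂ _∧_
        (cong (λ z → not (isPos z)) (countIn-flip-other (λ x → not (allowed x)) (cong not ae)))
        (all-cong (λ i → same-decision (+ deg (graph w′) i ℤ.≟ d i) (+ deg (graph w) i ℤ.≟ d′ i)
           (λ h → trans (move-right (trans (sym (deg-flip i)) h)) (sym (d′-eq i)))
           (λ h → trans (deg-flip i) (move-left (trans h (d′-eq i))))) (allFin n)))
      (sym (inG-as-count d′ (graph w))))
      where
      same-decision : ∀ {P Q : Set} (p? : Dec P) (q? : Dec Q) → (P → Q) → (Q → P) → does p? ≡ does q?
      same-decision (yes p) (yes q) f g = refl
      same-decision (no ¬p) (no ¬q) f g = refl
      same-decision (yes p) (no ¬q) f g = ⊥-elim (¬q (f p))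
      same-decision (no ¬p) (yes q) f g = ⊥-elim (¬p (g q))
      move-right : ∀ {x δ y} → x ℤ.+ δ ≡ y → x ≡ y ℤ.- δ
      move-right {x} {δ} refl = sym (add-sub x δ)
      move-left : ∀ {x δ y} → x ≡ y ℤ.- δ → x ℤ.+ δ ≡ y
      move-left {δ = δ} {y} refl = sub-add y δ

  count-graphs : ∀ (F : Graph n → Bool) →
    length (filter (λ G → F G Bool.≟ true) (allGraphs n)) ≡ count (λ w → F (graph w)) (bits m)
  count-graphs F = begin
      length (filter (λ G → F G Bool.≟ true) (allGraphs n))
    ≡⟨ length-filter (λ G → F G Bool.≟ true) (allGraphs n) ⟩
      count (λ G → does (F G Bool.≟ true)) (allGraphs n)
    ≡⟨ count-cong (λ G → does-≟true (F G)) (allGraphs n) ⟩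
      count F (allGraphs n)
    ≡⟨ cong (count F) (sublists-as-selections slots) ⟩
      count F (map (sel slots) (bits m))
    ≡⟨ sumL-map (λ G → 𝟙 (F G)) (sel slots) (bits m) ⟩
      count (λ w → F (graph w)) (bits m) ∎

  𝒩-as-count : ∀ d → 𝒩 A d ≡ count (valid d) (bits m)
  𝒩-as-count d = count-graphs (inG A d)

  𝒩E-as-count : ∀ d Es → 𝒩E A d Es ≡ count (λ w → valid d w ∧ containsAll (graph w) Es) (bits m)
  𝒩E-as-count d Es = count-graphs (λ G → inG A d G ∧ containsAll G Es)

  𝒩-cong : ∀ {D D′ : Fin n → ℤ} → (∀ i → D i ≡ D′ i) → 𝒩 A D ≡ 𝒩 A D′
  𝒩-cong {D} {D′} D≗D′ = trans (𝒩-as-count D) (trans (count-cong (λ w → cong (all allowed (graph w) ∧_)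
    (all-cong (λ i → cong (λ z → does (+ deg (graph w) i ℤ.≟ z)) (D≗D′ i)) (allFin n))) (bits m)) (sym (𝒩-as-count D′)))

  slot-ordered : ∀ {k e} → nth k slots ≡ just e → Ordered e
  slot-ordered {k} at = All-nth {k = k} (pairs-ordered n) at

  slot-of : ∀ {u v} → u ≢ v → Σ ℕ λ k → Σ (Pair n) λ e → nth k slots ≡ just e × joins u v e ≡ true
  slot-of {u} {v} u≢v = any-nth (joins u v) slots
    (trans (any-count (joins u v) slots) (positive (subst (1 ≤_) (sym (count-pairs-joining n u v)) one-order)))
    where
    positive : ∀ {c} → 1 ≤ c → isPos c ≡ true
    positive {suc c} _ = refl
    one-order : 1 ≤ 𝟙 (u <ᵇ v) + 𝟙 (v <ᵇ u)
    one-order with FinP.<-cmp u v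
    ... | tri< u<v _ _ = subst (λ z → 1 ≤ 𝟙 z + 𝟙 (v <ᵇ u)) (sym (dec-true (u Fin.<? v) u<v)) (s≤s z≤n)
    ... | tri≈ _ u≡v _ = ⊥-elim (u≢v u≡v)
    ... | tri> _ _ v<u = subst (λ z → 1 ≤ 𝟙 (u <ᵇ v) + 𝟙 z) (sym (dec-true (v Fin.<? u) v<u)) (ℕP.m≤n+m 1 (𝟙 (u <ᵇ v)))

  adj-≢ : ∀ {u v} → adj A u v ≡ true → u ≢ v
  adj-≢ {u} h refl with trans (sym h) (cong (λ z → if z then A u u else (if z then A u u else false)) (<ᵇ-irrefl u))
  ... | ()

  allowed-joins : ∀ {u v e} → joins u v e ≡ true → allowed e ≡ adj A u v
  allowed-joins {u} {v} {x , y} h with joins-sound {u = u} {v} {x} {y} h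
  ... | inj₁ (refl , refl) = refl
  ... | inj₂ (refl , refl) = adj-sym v u

  touches-joined : ∀ {a v : Fin n} {e : Pair n} → Ordered e → joins a v e ≡ true →
    ∀ i → 𝟙 (touches i e) ≡ 𝟙 (i == a) + 𝟙 (i == v)
  touches-joined {a} {v} {x , y} x<y h i with joins-sound {u = a} {v} {x} {y} h
  ... | inj₁ (refl , refl) = trans (disjoint-∨ (x == i) (y == i) (ordered-ends-distinct x<y i))
          (cong₂ _+_ (cong 𝟙 (==-sym x i)) (cong 𝟙 (==-sym y i)))
  ... | inj₂ (refl , refl) = trans (disjoint-∨ (x == i) (y == i) (ordered-ends-distinct x<y i))
          (trans (ℕP.+-comm (𝟙 (x == i)) _) (cong₂ _+_ (cong 𝟙 (==-sym y i)) (cong 𝟙 (==-sym x i))))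

  joins-unique : ∀ {a b v : Fin n} {e : Pair n} → Ordered e → joins a v e ≡ true → joins b v e ≡ true → a ≡ b
  joins-unique {a} {b} {v} {x , y} x<y h₁ h₂
    with joins-sound {u = a} {v} {x} {y} h₁ | joins-sound {u = b} {v} {x} {y} h₂
  ... | inj₁ (refl , refl) | inj₁ (refl , _) = refl
  ... | inj₂ (refl , refl) | inj₂ (_ , refl) = refl
  ... | inj₁ (refl , refl) | inj₂ (x≡v , _) = ⊥-elim (Ordered⇒≢ x<y x≡v)
  ... | inj₂ (refl , refl) | inj₁ (_ , y≡v) = ⊥-elim (Ordered⇒≢ x<y (sym y≡v))

  valid-parts : ∀ d w → valid d w ≡ true → all allowed (graph w) ≡ true × (∀ i → + deg (graph w) i ≡ d i)
  valid-parts d w h with ∧-elim (trans (sym (inG-as-count d (graph w))) h)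
  ... | h₁ , h₂ = trans (all-count allowed (graph w)) h₁ ,
                  λ i → does-sound (+ deg (graph w) i ℤ.≟ d i) (all-allFin _ h₂ i)

  edge-allowed : ∀ d u v w → valid d w ≡ true → edge u v w ≡ true → adj A u v ≡ true
  edge-allowed d u v w vw ew
    with any-all (joins u v) allowed (graph w)
           (trans (any-count (joins u v) (graph w)) (trans (sym (hasEdge-count (graph w) u v)) ew))
           (proj₁ (valid-parts d w vw))
  ... | (x , y) , j , a = trans (sym (allowed-joins {u} {v} {x , y} j)) a

module EdgeToggle (n : ℕ) (A : Allowed n) where
  -- Identity (I): 𝒩_av(d) + 𝒩_av(d−e_a−e_v) = 𝒩(d−e_a−e_v) whenever 𝒩_av(d) > 0.
  -- Flipping the slot of {a,v} maps the graphs of 𝒢_𝒜(d) containing av onto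
  -- the graphs of 𝒢_𝒜(d−e_a−e_v) not containing av.

  open Counting
  open BitVectors
  open FinPairs
  open UnitVectors
  open GraphEncoding n A
  open import Data.Nat using (_+_; _<_)
  open import Data.Integer using (+_)

  module _ (d : Fin n → ℤ) (a v : Fin n) (k : ℕ) (e : Pair n) (at : nth k slots ≡ just e)
           (je : joins a v e ≡ true) (ae : allowed e ≡ true) where
    D : Fin n → ℤ
    D = (d -e a) -e v

    toggled : ∀ w → length w ≡ m →
      (valid d (flip k w) ∧ (edge a v (flip k w) ∧ true)) ≡ (valid D w ∧ not (edge a v w))
    toggled w len = by-bit T.bit (proj₁ (T.edge-flip a v je)) (proj₂ (T.edge-flip a v je))
        (λ absent → T.valid-flip d D ae (D-shift absent))
      where
      module T = Toggle k e at w len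
      -- removing av from a graph of degree d leaves one of degree D
      D-shift : T.bit ≡ false → ∀ i → D i ≡ d i ℤ.- T.shift i
      D-shift absent i = begin
          ((d -e a) -e v) i                                ≡⟨ -e-pair d a v i ⟩
          d i ℤ.- (+ 𝟙 (i == a) ℤ.+ + 𝟙 (i == v))          ≡⟨ cong (λ z → d i ℤ.- z) (sym (ℤP.pos-+ (𝟙 (i == a)) _)) ⟩
          d i ℤ.- + (𝟙 (i == a) + 𝟙 (i == v))              ≡⟨ cong (λ z → d i ℤ.- + z) (sym (touches-joined (slot-ordered {k} at) je i)) ⟩
          d i ℤ.- + 𝟙 (touches i e)                        ≡⟨ cong (λ z → d i ℤ.- z) (sym (T.shift-absent absent i)) ⟩
          d i ℤ.- T.shift i ∎
      by-bit : ∀ b → edge a v w ≡ b → edge a v (flip k w) ≡ not b → (b ≡ false → valid d (flip k w) ≡ valid D w) →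
        (valid d (flip k w) ∧ (edge a v (flip k w) ∧ true)) ≡ (valid D w ∧ not (edge a v w))
      by-bit true before after _ rewrite before | after = trans (BoolP.∧-zeroʳ _) (sym (BoolP.∧-zeroʳ _))
      by-bit false before after f rewrite before | after = cong (_∧ true) (f refl)

    edge-toggle-at : 𝒩edge A d a v + 𝒩edge A D a v ≡ 𝒩 A D
    edge-toggle-at = begin
        𝒩edge A d a v + 𝒩edge A D a v
      ≡⟨ cong₂ _+_ (𝒩E-as-count d ((a , v) ∷ [])) (𝒩E-as-count D ((a , v) ∷ [])) ⟩
        count (λ w → valid d w ∧ (edge a v w ∧ true)) (bits m) + count (λ w → valid D w ∧ (edge a v w ∧ true)) (bits m)
      ≡⟨ cong (_+ count (λ w → valid D w ∧ (edge a v w ∧ true)) (bits m))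
           (trans (sym (count-flip-invariant m k (λ w → valid d w ∧ (edge a v w ∧ true)))) (count-cong-bits m toggled)) ⟩
        count (λ w → valid D w ∧ not (edge a v w)) (bits m) + count (λ w → valid D w ∧ (edge a v w ∧ true)) (bits m)
      ≡⟨ sym (sumL-+ _ _ (bits m)) ⟩
        sumL (λ w → 𝟙 (valid D w ∧ not (edge a v w)) + 𝟙 (valid D w ∧ (edge a v w ∧ true))) (bits m)
      ≡⟨ sumL-cong (λ w → without-plus-with (valid D w) (edge a v w)) (bits m) ⟩
        count (valid D) (bits m)
      ≡⟨ sym (𝒩-as-count D) ⟩
        𝒩 A D ∎
      where
      without-plus-with : ∀ x y → 𝟙 (x ∧ not y) + 𝟙 (x ∧ (y ∧ true)) ≡ 𝟙 x
      without-plus-with true true = refl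
      without-plus-with true false = refl
      without-plus-with false y = refl

  edge-witness : ∀ d a v → 0 < 𝒩edge A d a v → Σ (List Bool) λ w → valid d w ≡ true × edge a v w ≡ true
  edge-witness d a v h with count-witness _ (bits m) (subst (0 <_) (𝒩E-as-count d ((a , v) ∷ [])) h)
  ... | w , hw = w , proj₁ (∧-elim hw) , proj₁ (∧-elim (proj₂ (∧-elim {valid d w} hw)))

  𝒩edge-allowed : ∀ d a v → 0 < 𝒩edge A d a v → adj A a v ≡ true
  𝒩edge-allowed d a v h with edge-witness d a v h
  ... | w , vw , ew = edge-allowed d a v w vw ew

  edge-toggle : ∀ d a v → 0 < 𝒩edge A d a v →
    𝒩edge A d a v + 𝒩edge A ((d -e a) -e v) a v ≡ 𝒩 A ((d -e a) -e v)
  edge-toggle d a v h with slot-of (adj-≢ (𝒩edge-allowed d a v h))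
  ... | k , e , at , je = edge-toggle-at d a v k e at je (trans (allowed-joins {a} {v} {e} je) (𝒩edge-allowed d a v h))

module DegreeSum (n : ℕ) (A : Allowed n) where
  -- Identity (II): Σ_b 𝒩_bv(d) = d_v 𝒩(d), obtained by counting pairs
  -- (G, b) with G ∈ 𝒢_𝒜(d) and bv ∈ G in two ways.

  open Counting
  open BitVectors
  open FinPairs
  open GraphEncoding n A
  open import Data.Nat using (_+_; _*_; _≤_; _<_)
  open import Data.Integer using (+_)

  count-partners : ∀ v (x y : Fin n) → x Fin.< y → sumL (λ b → 𝟙 (joins b v (x , y))) (allFin n) ≡ 𝟙 (touches v (x , y))
  count-partners v x y x<y = begin
      sumL (λ b → 𝟙 (joins b v (x , y))) (allFin n)
    ≡⟨ sumL-cong (λ b → disjoint-∨ ((x == b) ∧ (y == v)) ((x == v) ∧ (y == b)) (not-both b)) (allFin n) ⟩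
      sumL (λ b → 𝟙 ((x == b) ∧ (y == v)) + 𝟙 ((x == v) ∧ (y == b))) (allFin n)
    ≡⟨ sumL-+ _ _ (allFin n) ⟩
      count (λ b → (x == b) ∧ (y == v)) (allFin n) + count (λ b → (x == v) ∧ (y == b)) (allFin n)
    ≡⟨ cong₂ _+_
         (trans (count-cong (λ b → cong (_∧ (y == v)) (==-sym x b)) (allFin n)) (count-select n x (λ _ → y == v)))
         (trans (count-cong (λ b → trans (BoolP.∧-comm (x == v) (y == b)) (cong (_∧ (x == v)) (==-sym y b))) (allFin n))
                (count-select n y (λ _ → x == v))) ⟩
      𝟙 (y == v) + 𝟙 (x == v)
    ≡⟨ ℕP.+-comm (𝟙 (y == v)) (𝟙 (x == v)) ⟩
      𝟙 (x == v) + 𝟙 (y == v)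
    ≡⟨ sym (disjoint-∨ (x == v) (y == v) (ordered-ends-distinct x<y v)) ⟩
      𝟙 (touches v (x , y)) ∎
    where
    not-both : ∀ b → ((x == b) ∧ (y == v)) ∧ ((x == v) ∧ (y == b)) ≡ false
    not-both b with x == b in x≡b | (x == v) ∧ (y == b) in rest
    ... | false | _ = refl
    ... | true | false = BoolP.∧-zeroʳ _
    ... | true | true = ⊥-elim (Ordered⇒≢ x<y (trans (==-sound x≡b) (sym (==-sound (proj₂ (∧-elim rest))))))

  count-neighbours : ∀ v w → sumL (λ b → 𝟙 (edge b v w)) (allFin n) ≡ deg (graph w) v
  count-neighbours v w = begin
      sumL (λ b → 𝟙 (edge b v w)) (allFin n)
    ≡⟨ sumL-cong (λ b → trans (cong 𝟙 (hasEdge-count (graph w) b v)) (at-most-one (countIn-joins-≤1 b v w))) (allFin n) ⟩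
      sumL (λ b → countIn (joins b v) w) (allFin n)
    ≡⟨ sumL-swap (λ b e → 𝟙 (joins b v e)) (allFin n) (graph w) ⟩
      sumL (λ e → sumL (λ b → 𝟙 (joins b v e)) (allFin n)) (graph w)
    ≡⟨ sumL-cong-All (λ { (x , y) x<y → count-partners v x y x<y }) (All-sel w (pairs-ordered n)) ⟩
      count (touches v) (graph w)
    ≡⟨ sym (deg-count (graph w) v) ⟩
      deg (graph w) v ∎
    where
    at-most-one : ∀ {c} → c ≤ 1 → 𝟙 (isPos c) ≡ c
    at-most-one {zero} _ = refl
    at-most-one {suc zero} _ = refl
    at-most-one {suc (suc c)} (s≤s ())

  sum-of-degrees : ∀ d v ws → + sumL (λ w → 𝟙 (valid d w) * deg (graph w) v) ws ≡ d v ℤ.* + count (valid d) ws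
  sum-of-degrees d v [] = sym (ℤP.*-zeroʳ (d v))
  sum-of-degrees d v (w ∷ ws) with valid d w in vw
  ... | true = begin
      + (deg (graph w) v + 0 + sumL (λ w → 𝟙 (valid d w) * deg (graph w) v) ws)
    ≡⟨ ℤP.pos-+ (deg (graph w) v + 0) _ ⟩
      + (deg (graph w) v + 0) ℤ.+ + sumL (λ w → 𝟙 (valid d w) * deg (graph w) v) ws
    ≡⟨ cong₂ ℤ._+_ (trans (cong +_ (ℕP.+-identityʳ _)) (proj₂ (valid-parts d w vw) v)) (sum-of-degrees d v ws) ⟩
      d v ℤ.+ d v ℤ.* + count (valid d) ws
    ≡⟨ cong (ℤ._+ d v ℤ.* + count (valid d) ws) (sym (ℤP.*-identityʳ (d v))) ⟩
      d v ℤ.* + 1 ℤ.+ d v ℤ.* + count (valid d) ws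
    ≡⟨ sym (ℤP.*-distribˡ-+ (d v) (+ 1) _) ⟩
      d v ℤ.* + (1 + count (valid d) ws) ∎
  ... | false = sum-of-degrees d v ws

  degree-sum : ∀ d v → + sumL (λ b → 𝒩edge A d b v) (allFin n) ≡ d v ℤ.* + 𝒩 A d
  degree-sum d v = begin
      + sumL (λ b → 𝒩edge A d b v) (allFin n)
    ≡⟨ cong +_ (sumL-cong (λ b → 𝒩E-as-count d ((b , v) ∷ [])) (allFin n)) ⟩
      + sumL (λ b → count (λ w → valid d w ∧ (edge b v w ∧ true)) (bits m)) (allFin n)
    ≡⟨ cong +_ (sumL-swap (λ b w → 𝟙 (valid d w ∧ (edge b v w ∧ true))) (allFin n) (bits m)) ⟩
      + sumL (λ w → sumL (λ b → 𝟙 (valid d w ∧ (edge b v w ∧ true))) (allFin n)) (bits m)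
    ≡⟨ cong +_ (sumL-cong per-graph (bits m)) ⟩
      + sumL (λ w → 𝟙 (valid d w) * deg (graph w) v) (bits m)
    ≡⟨ sum-of-degrees d v (bits m) ⟩
      d v ℤ.* + count (valid d) (bits m)
    ≡⟨ cong (λ z → d v ℤ.* + z) (sym (𝒩-as-count d)) ⟩
      d v ℤ.* + 𝒩 A d ∎
    where
    indicator-∧ : ∀ x y → 𝟙 (x ∧ (y ∧ true)) ≡ 𝟙 x * 𝟙 y
    indicator-∧ true true = refl
    indicator-∧ true false = refl
    indicator-∧ false y = refl
    per-graph : ∀ w → sumL (λ b → 𝟙 (valid d w ∧ (edge b v w ∧ true))) (allFin n) ≡ 𝟙 (valid d w) * deg (graph w) v
    per-graph w = trans (sumL-cong (λ b → indicator-∧ (valid d w) (edge b v w)) (allFin n))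
      (trans (sym (sumL-*ˡ (𝟙 (valid d w)) (λ b → 𝟙 (edge b v w)) (allFin n)))
             (cong (𝟙 (valid d w) *_) (count-neighbours v w)))

  𝒩edge-≤ : ∀ d a v → 𝒩edge A d a v ≤ 𝒩 A d
  𝒩edge-≤ d a v = subst₂ _≤_ (sym (𝒩E-as-count d ((a , v) ∷ []))) (sym (𝒩-as-count d))
    (sumL-mono (λ w → ∧-≤ (valid d w) _) (bits m))
    where
    ∧-≤ : ∀ x y → 𝟙 (x ∧ y) ≤ 𝟙 x
    ∧-≤ true true = s≤s z≤n
    ∧-≤ true false = z≤n
    ∧-≤ false y = z≤n

  realisable-nonneg : ∀ D → Realisable A D → ∀ i → Σ ℕ (λ c → D i ≡ + c)
  realisable-nonneg D h i with count-witness (valid D) (bits m) (subst (0 <_) (𝒩-as-count D) h)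
  ... | w , vw = deg (graph w) i , sym (proj₂ (valid-parts D w vw) i)

  𝒩edge-sym : ∀ D u v → 𝒩edge A D u v ≡ 𝒩edge A D v u
  𝒩edge-sym D u v = trans (𝒩E-as-count D ((u , v) ∷ []))
    (trans (count-cong (λ w → cong (λ z → valid D w ∧ (z ∧ true))
        (any-cong (λ { (x , y) → BoolP.∨-comm ((x == u) ∧ (y == v)) ((x == v) ∧ (y == u)) }) (graph w))) (bits m))
      (sym (𝒩E-as-count D ((v , u) ∷ []))))

module Switching (n : ℕ) (A : Allowed n) where
  -- For a ≠ b let 𝒮(i,j,D) count the graphs of 𝒢_𝒜(D) that
  -- contain iv but not jv, with jv allowed, summed over v.  Flipping the
  -- slots of {a,v} and {b,v} matches 𝒮(a,b,d−e_b) with 𝒮(b,a,d−e_a).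

  open Counting
  open BitVectors
  open FinPairs
  open UnitVectors
  open GraphEncoding n A
  open import Data.Integer using (+_)

  switchable : Fin n → Fin n → (Fin n → ℤ) → Fin n → ℕ
  switchable i j D v = count (λ w → valid D w ∧ (edge i v w ∧ (not (edge j v w) ∧ adj A j v))) (bits m)

  𝒮 : Fin n → Fin n → (Fin n → ℤ) → ℕ
  𝒮 i j D = sumL (switchable i j D) (allFin n)

  disallowed-absent : ∀ {u v} → adj A u v ≡ false → ∀ D w r → (valid D w ∧ (edge u v w ∧ r)) ≡ false
  disallowed-absent {u} {v} h D w r with valid D w in vw | edge u v w in ew
  ... | true | true with trans (sym h) (edge-allowed D u v w vw ew)
  ...   | ()
  disallowed-absent h D w r | true | false = refl
  disallowed-absent h D w r | false | _ = refl

  ∧-false-inside : ∀ x y z → (x ∧ (y ∧ (z ∧ false))) ≡ false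
  ∧-false-inside x y z = trans (cong (λ t → x ∧ (y ∧ t)) (BoolP.∧-zeroʳ z))
                           (trans (cong (x ∧_) (BoolP.∧-zeroʳ y)) (BoolP.∧-zeroʳ x))

  module Swap (d : Fin n → ℤ) (a b v : Fin n) (a≢b : a ≢ b)
              (k₁ : ℕ) (e₁ : Pair n) (at₁ : nth k₁ slots ≡ just e₁) (je₁ : joins a v e₁ ≡ true) (ae₁ : allowed e₁ ≡ true)
              (k₂ : ℕ) (e₂ : Pair n) (at₂ : nth k₂ slots ≡ just e₂) (je₂ : joins b v e₂ ≡ true) (ae₂ : allowed e₂ ≡ true) where
    D₁ D₂ : Fin n → ℤ
    D₁ = d -e b
    D₂ = d -e a

    other-slot : ∀ {x y e} → Ordered e → x ≢ y → joins x v e ≡ true → joins y v e ≡ false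
    other-slot {x} {y} {e} o x≢y h with joins y v e in h′
    ... | true = ⊥-elim (x≢y (joins-unique o h h′))
    ... | false = refl

    touches-ℤ : ∀ {x e k} → nth k slots ≡ just e → joins x v e ≡ true →
      ∀ i → + 𝟙 (touches i e) ≡ + 𝟙 (i == x) ℤ.+ + 𝟙 (i == v)
    touches-ℤ {x} {e} {k} at je i =
      trans (cong +_ (touches-joined (slot-ordered {k} at) je i)) (ℤP.pos-+ (𝟙 (i == x)) _)

    -- Both D₁ + e_b + e_v and D₂ + e_a + e_v equal d + e_v.
    middle : Fin n → ℤ
    middle i = d i ℤ.+ + 𝟙 (i == v)

    swapped : ∀ w → length w ≡ m →
      (valid D₂ (flip k₁ (flip k₂ w)) ∧ (edge b v (flip k₁ (flip k₂ w)) ∧ (not (edge a v (flip k₁ (flip k₂ w))) ∧ true)))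
        ≡ (valid D₁ w ∧ (edge a v w ∧ (not (edge b v w) ∧ true)))
    swapped w len = by-edges (edge a v w) (edge b v w) refl refl
      where
      w₂ = flip k₂ w
      w₁ = flip k₁ w₂
      module T₂ = Toggle k₂ e₂ at₂ w len
      module T₁ = Toggle k₁ e₁ at₁ w₂ (trans (flip-length k₂ w) len)
      bv-before : edge b v w ≡ T₂.bit
      bv-before = proj₁ (T₂.edge-flip b v je₂)
      bv-middle : edge b v w₂ ≡ not T₂.bit
      bv-middle = proj₂ (T₂.edge-flip b v je₂)
      av-middle : edge a v w₂ ≡ edge a v w
      av-middle = T₂.edge-unchanged a v (other-slot (slot-ordered {k₂} at₂) (λ b≡a → a≢b (sym b≡a)) je₂)
      av-middle′ : edge a v w₂ ≡ T₁.bit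
      av-middle′ = proj₁ (T₁.edge-flip a v je₁)
      av-after : edge a v w₁ ≡ not T₁.bit
      av-after = proj₂ (T₁.edge-flip a v je₁)
      bv-after : edge b v w₁ ≡ edge b v w₂
      bv-after = T₁.edge-unchanged b v (other-slot (slot-ordered {k₁} at₁) a≢b je₁)
      valid-swapped : edge a v w ≡ true → edge b v w ≡ false → valid D₂ w₁ ≡ valid D₁ w
      valid-swapped av∈w bv∉w = trans (T₁.valid-flip D₂ middle ae₁ via-a) (T₂.valid-flip middle D₁ ae₂ via-b)
        where
        via-a : ∀ i → middle i ≡ D₂ i ℤ.- T₁.shift i
        via-a i = begin
            d i ℤ.+ + 𝟙 (i == v)                          ≡⟨ sym (-e-restore d a v i) ⟩
            D₂ i ℤ.+ (+ 𝟙 (i == a) ℤ.+ + 𝟙 (i == v))      ≡⟨ cong (λ z → D₂ i ℤ.+ z) (sym (touches-ℤ {k = k₁} at₁ je₁ i)) ⟩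
            D₂ i ℤ.+ + 𝟙 (touches i e₁)                   ≡⟨ cong (λ z → D₂ i ℤ.+ z) (sym (ℤP.neg-involutive _)) ⟩
            D₂ i ℤ.- (ℤ.- + 𝟙 (touches i e₁))             ≡⟨ cong (λ z → D₂ i ℤ.- z)
                                                              (sym (T₁.shift-present (trans (sym av-middle′) (trans av-middle av∈w)) i)) ⟩
            D₂ i ℤ.- T₁.shift i ∎
        via-b : ∀ i → D₁ i ≡ middle i ℤ.- T₂.shift i
        via-b i = begin
            D₁ i                                                      ≡⟨ sym (add-sub (D₁ i) _) ⟩
            (D₁ i ℤ.+ + 𝟙 (touches i e₂)) ℤ.- + 𝟙 (touches i e₂)     ≡⟨ cong (λ z → (D₁ i ℤ.+ z) ℤ.- + 𝟙 (touches i e₂)) (touches-ℤ {k = k₂} at₂ je₂ i) ⟩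
            (D₁ i ℤ.+ (+ 𝟙 (i == b) ℤ.+ + 𝟙 (i == v))) ℤ.- + 𝟙 (touches i e₂)
                                                                      ≡⟨ cong₂ ℤ._-_ (-e-restore d b v i) (sym (T₂.shift-absent (trans (sym bv-before) bv∉w) i)) ⟩
            middle i ℤ.- T₂.shift i ∎
      by-edges : ∀ p q → edge a v w ≡ p → edge b v w ≡ q →
        (valid D₂ w₁ ∧ (edge b v w₁ ∧ (not (edge a v w₁) ∧ true))) ≡ (valid D₁ w ∧ (edge a v w ∧ (not (edge b v w) ∧ true)))
      by-edges p q hp hq = begin
          valid D₂ w₁ ∧ (edge b v w₁ ∧ (not (edge a v w₁) ∧ true))
        ≡⟨ cong₂ (λ s t → valid D₂ w₁ ∧ (s ∧ (not t ∧ true)))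
             (trans bv-after (trans bv-middle (cong not (trans (sym bv-before) hq))))
             (trans av-after (cong not (trans (sym av-middle′) (trans av-middle hp)))) ⟩
          valid D₂ w₁ ∧ (not q ∧ (not (not p) ∧ true))
        ≡⟨ only-case p q (λ p≡t q≡f → valid-swapped (trans hp p≡t) (trans hq q≡f)) ⟩
          valid D₁ w ∧ (p ∧ (not q ∧ true))
        ≡⟨ cong₂ (λ s t → valid D₁ w ∧ (s ∧ (not t ∧ true))) (sym hp) (sym hq) ⟩
          valid D₁ w ∧ (edge a v w ∧ (not (edge b v w) ∧ true)) ∎
        where
        only-case : ∀ p q → (p ≡ true → q ≡ false → valid D₂ w₁ ≡ valid D₁ w) →
          (valid D₂ w₁ ∧ (not q ∧ (not (not p) ∧ true))) ≡ (valid D₁ w ∧ (p ∧ (not q ∧ true)))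
        only-case true false h = cong (_∧ true) (h refl refl)
        only-case true true _ = trans (BoolP.∧-zeroʳ _) (sym (BoolP.∧-zeroʳ _))
        only-case false true _ = trans (BoolP.∧-zeroʳ _) (sym (BoolP.∧-zeroʳ _))
        only-case false false _ = trans (BoolP.∧-zeroʳ _) (sym (BoolP.∧-zeroʳ _))

    switchable-swap : count (λ w → valid D₂ w ∧ (edge b v w ∧ (not (edge a v w) ∧ true))) (bits m)
                    ≡ count (λ w → valid D₁ w ∧ (edge a v w ∧ (not (edge b v w) ∧ true))) (bits m)
    switchable-swap = trans (sym (count-flip-invariant m k₁ F))
      (trans (sym (count-flip-invariant m k₂ (λ w → F (flip k₁ w)))) (count-cong-bits m swapped))
      where
      F = λ w → valid D₂ w ∧ (edge b v w ∧ (not (edge a v w) ∧ true))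

  -- Pointwise switching; if av or bv is not allowed both counts vanish.
  switchable-symmetric : ∀ d a b → a ≢ b → ∀ v → switchable a b (d -e b) v ≡ switchable b a (d -e a) v
  switchable-symmetric d a b a≢b v with adj A a v in av | adj A b v in bv
  ... | _ | false = trans (count-zero _ (λ w → ∧-false-inside (valid (d -e b) w) (edge a v w) _) (bits m))
                          (sym (count-zero _ (λ w → disallowed-absent bv (d -e a) w _) (bits m)))
  ... | false | true = trans (count-zero _ (λ w → disallowed-absent av (d -e b) w _) (bits m))
                             (sym (count-zero _ (λ w → ∧-false-inside (valid (d -e a) w) (edge b v w) _) (bits m)))
  ... | true | true with slot-of (adj-≢ av) | slot-of (adj-≢ bv)
  ... | k₁ , e₁ , at₁ , je₁ | k₂ , e₂ , at₂ , je₂ =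
    sym (Swap.switchable-swap d a b v a≢b k₁ e₁ at₁ je₁ (trans (allowed-joins {a} {v} {e₁} je₁) av)
                                          k₂ e₂ at₂ je₂ (trans (allowed-joins {b} {v} {e₂} je₂) bv))

  switching : ∀ d a b → a ≢ b → 𝒮 a b (d -e b) ≡ 𝒮 b a (d -e a)
  switching d a b a≢b = sumL-cong (switchable-symmetric d a b a≢b) (allFin n)

module BComplement (n : ℕ) (A : Allowed n) where
  -- The numerators of the two sums in B(i,j,D), and the graphs counted by
  -- 𝒮(i,j,D), together count every pair (G, v) with iv ∈ G ∈ 𝒢_𝒜(D); by (II)
  -- there are D_i 𝒩(D) such pairs.

  open Counting
  open BitVectors
  open GraphEncoding n A
  open DegreeSum n A
  open Switching n A
  open import Data.Nat using (_+_; _*_)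
  open import Data.Integer using (+_)

  B-sum₁ B-sum₂ : Fin n → Fin n → (Fin n → ℤ) → ℕ
  B-sum₁ i j D = sumL (λ v → 𝒩edge A D i v) (filter (λ v → (adj A i v ∧ not (adj A j v)) Bool.≟ true) (allFin n))
  B-sum₂ i j D = sumL (λ v → 𝒩E A D ((i , v) ∷ (j , v) ∷ [])) (filter (λ v → (adj A i v ∧ adj A j v) Bool.≟ true) (allFin n))

  split-at : ∀ i j D v → 𝟙 (adj A i v ∧ not (adj A j v)) * 𝒩edge A D i v
                       + 𝟙 (adj A i v ∧ adj A j v) * 𝒩E A D ((i , v) ∷ (j , v) ∷ []) + switchable i j D v ≡ 𝒩edge A D i v
  split-at i j D v = trans (cong₂ (λ p q → 𝟙 (adj A i v ∧ not (adj A j v)) * p + 𝟙 (adj A i v ∧ adj A j v) * q + switchable i j D v)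
                          (𝒩E-as-count D ((i , v) ∷ [])) (𝒩E-as-count D ((i , v) ∷ (j , v) ∷ [])))
                    (trans (by-adjacency (adj A i v) (adj A j v) refl refl) (sym (𝒩E-as-count D ((i , v) ∷ []))))
    where
    with-iv = count (λ w → valid D w ∧ (edge i v w ∧ true)) (bits m)
    with-iv-jv = count (λ w → valid D w ∧ (edge i v w ∧ (edge j v w ∧ true))) (bits m)
    with-iv-not-jv : Bool → ℕ
    with-iv-not-jv c = count (λ w → valid D w ∧ (edge i v w ∧ (not (edge j v w) ∧ c))) (bits m)
    jv-or-not : ∀ x y z → 𝟙 (x ∧ (y ∧ (z ∧ true))) + 𝟙 (x ∧ (y ∧ (not z ∧ true))) ≡ 𝟙 (x ∧ (y ∧ true))
    jv-or-not true true true = refl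
    jv-or-not true true false = refl
    jv-or-not true false z = refl
    jv-or-not false y z = refl
    by-adjacency : ∀ ai aj → adj A i v ≡ ai → adj A j v ≡ aj →
      𝟙 (ai ∧ not aj) * with-iv + 𝟙 (ai ∧ aj) * with-iv-jv + with-iv-not-jv aj ≡ with-iv
    by-adjacency true true _ _ = trans (cong (_+ with-iv-not-jv true) (ℕP.*-identityˡ with-iv-jv))
      (trans (sym (sumL-+ _ _ (bits m))) (sumL-cong (λ w → jv-or-not (valid D w) (edge i v w) (edge j v w)) (bits m)))
    by-adjacency true false _ _ = trans (cong₂ _+_ (trans (ℕP.+-identityʳ (1 * with-iv)) (ℕP.*-identityˡ with-iv))
        (count-zero _ (λ w → ∧-false-inside (valid D w) (edge i v w) (not (edge j v w))) (bits m)))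
      (ℕP.+-identityʳ with-iv)
    by-adjacency false aj iv-disallowed _ = trans (count-zero _ (λ w → disallowed-absent iv-disallowed D w _) (bits m))
      (sym (count-zero _ (λ w → disallowed-absent iv-disallowed D w true) (bits m)))

  B-split : ∀ i j D → + (B-sum₁ i j D + B-sum₂ i j D + 𝒮 i j D) ≡ D i ℤ.* + 𝒩 A D
  B-split i j D = trans (cong +_ (begin
      B-sum₁ i j D + B-sum₂ i j D + 𝒮 i j D
    ≡⟨ cong₂ (λ p q → p + q + 𝒮 i j D)
         (trans (sumL-filter _ _ (allFin n)) (sumL-cong (λ v → cong (λ z → 𝟙 z * 𝒩edge A D i v) (does-≟true (adj A i v ∧ not (adj A j v)))) (allFin n)))
         (trans (sumL-filter _ _ (allFin n)) (sumL-cong (λ v → cong (λ z → 𝟙 z * 𝒩E A D ((i , v) ∷ (j , v) ∷ [])) (does-≟true (adj A i v ∧ adj A j v))) (allFin n))) ⟩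
      sumL f₁ (allFin n) + sumL f₂ (allFin n) + 𝒮 i j D
    ≡⟨ cong (_+ 𝒮 i j D) (sym (sumL-+ f₁ f₂ (allFin n))) ⟩
      sumL (λ v → f₁ v + f₂ v) (allFin n) + 𝒮 i j D
    ≡⟨ sym (sumL-+ _ _ (allFin n)) ⟩
      sumL (λ v → f₁ v + f₂ v + switchable i j D v) (allFin n)
    ≡⟨ sumL-cong (split-at i j D) (allFin n) ⟩
      sumL (λ v → 𝒩edge A D i v) (allFin n)
    ≡⟨ sumL-cong (λ v → 𝒩edge-sym D i v) (allFin n) ⟩
      sumL (λ v → 𝒩edge A D v i) (allFin n) ∎))
    (degree-sum D i)
    where
    f₁ = λ v → 𝟙 (adj A i v ∧ not (adj A j v)) * 𝒩edge A D i v
    f₂ = λ v → 𝟙 (adj A i v ∧ adj A j v) * 𝒩E A D ((i , v) ∷ (j , v) ∷ [])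

module Formulas (n : ℕ) (A : Allowed n) where

  open Counting
  open DivisionFacts
  open UnitVectors
  open GraphEncoding n A using (𝒩-cong; adj-sym)
  open EdgeToggle n A
  open DegreeSum n A
  open Switching n A
  open BComplement n A
  open import Data.Nat using (_≤_; _<_)
  open import Data.Integer using (+_)
  open import Data.Rational using (_+_; _*_; _-_)

  sumℚ-ℤ→ℚ : ∀ {X : Set} (f : X → ℕ) xs → sumℚ (map (λ x → ℤ→ℚ (+ f x)) xs) ≡ ℤ→ℚ (+ sumL f xs)
  sumℚ-ℤ→ℚ f [] = refl
  sumℚ-ℤ→ℚ f (x ∷ xs) = trans (cong (λ z → ℤ→ℚ (+ f x) + z) (sumℚ-ℤ→ℚ f xs))
    (sym (trans (cong ℤ→ℚ (ℤP.pos-+ (f x) (sumL f xs))) (ℤ→ℚ-+ (+ f x) (+ sumL f xs))))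

  degree-≢0 : ∀ (d : Fin n → ℤ) i → Realisable A (d -e i) → ℤ→ℚ (d i) ≢ 0ℚ
  degree-≢0 d i real = ℤ→ℚ-≢0 (d i) (d≢0 (realisable-nonneg (d -e i) real i))
    where
    d≢0 : Σ ℕ (λ c → (d -e i) i ≡ + c) → d i ≢ + 0
    d≢0 (c , d-eᵢ≡c) dᵢ≡0 with ℤP.+-injective (begin
      + suc c               ≡⟨ cong +_ (ℕP.+-comm 1 c) ⟩
      + (c ℕ.+ 1)           ≡⟨ ℤP.pos-+ c 1 ⟩
      + c ℤ.+ + 1           ≡⟨ cong (ℤ._+ + 1) (sym d-eᵢ≡c) ⟩
      (d -e i) i ℤ.+ + 1    ≡⟨ -e-self d i ⟩
      d i                   ≡⟨ dᵢ≡0 ⟩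
      + 0 ∎)
    ... | ()

  B-as-ratio : ∀ i j D → Bf A i j D ≡
    (1ℚ ÷₀ ℤ→ℚ (D i)) * (ℤ→ℚ (+ (B-sum₁ i j D ℕ.+ B-sum₂ i j D)) ÷₀ ℤ→ℚ (+ 𝒩 A D))
  B-as-ratio i j D = cong ((1ℚ ÷₀ ℤ→ℚ (D i)) *_) (begin
      sumℚ (map (λ v → Pe A D i v) F₁) + sumℚ (map (λ v → Ppath A D i v j) F₂)
    ≡⟨ cong₂ _+_ (sum-over F₁ (λ v → 𝒩edge A D i v)) (sum-over F₂ (λ v → 𝒩E A D ((i , v) ∷ (j , v) ∷ []))) ⟩
      ℤ→ℚ (+ B-sum₁ i j D) ÷₀ N + ℤ→ℚ (+ B-sum₂ i j D) ÷₀ N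
    ≡⟨ sym (÷₀-distrib-+ (ℤ→ℚ (+ B-sum₁ i j D)) (ℤ→ℚ (+ B-sum₂ i j D)) N) ⟩
      (ℤ→ℚ (+ B-sum₁ i j D) + ℤ→ℚ (+ B-sum₂ i j D)) ÷₀ N
    ≡⟨ cong (_÷₀ N) (sym (trans (cong ℤ→ℚ (ℤP.pos-+ (B-sum₁ i j D) (B-sum₂ i j D))) (ℤ→ℚ-+ (+ B-sum₁ i j D) (+ B-sum₂ i j D)))) ⟩
      ℤ→ℚ (+ (B-sum₁ i j D ℕ.+ B-sum₂ i j D)) ÷₀ N ∎)
    where
    F₁ = filter (λ v → (adj A i v ∧ not (adj A j v)) Bool.≟ true) (allFin n)
    F₂ = filter (λ v → (adj A i v ∧ adj A j v) Bool.≟ true) (allFin n)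
    N = ℤ→ℚ (+ 𝒩 A D)
    sum-over : ∀ vs (g : Fin n → ℕ) → sumℚ (map (λ v → ℤ→ℚ (+ g v) ÷₀ N) vs) ≡ ℤ→ℚ (+ sumL g vs) ÷₀ N
    sum-over vs g = trans (sumℚ-÷₀ (λ v → ℤ→ℚ (+ g v)) N vs) (cong (_÷₀ N) (sumℚ-ℤ→ℚ g vs))

  complement-B : ∀ i j D → ℤ→ℚ (D i) * ℤ→ℚ (+ 𝒩 A D) * (1ℚ - Bf A i j D) ≡ ℤ→ℚ (+ 𝒮 i j D)
  complement-B i j D = trans (cong (λ z → ℤ→ℚ (D i) * ℤ→ℚ (+ 𝒩 A D) * (1ℚ - z)) (B-as-ratio i j D))
    (complement-scaled (D i) (𝒩 A D) (B-sum₁ i j D ℕ.+ B-sum₂ i j D) (𝒮 i j D) (B-split i j D))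

  -- Part (b).  For a = b both sides are 1; otherwise (III) gives the balance.
  part-b : ∀ d (a b : Fin n) → Realisable A (d -e b) → Bf A b a (d -e a) ≢ 1ℚ →
    R A a b d ≡ (ℤ→ℚ (d a) ÷₀ ℤ→ℚ (d b)) * ((1ℚ - Bf A a b (d -e b)) ÷₀ (1ℚ - Bf A b a (d -e a)))
  part-b d a b real B≢1 = by-cases (a Fin.≟ b)
    where
    by-cases : Dec (a ≡ b) →
      R A a b d ≡ (ℤ→ℚ (d a) ÷₀ ℤ→ℚ (d b)) * ((1ℚ - Bf A a b (d -e b)) ÷₀ (1ℚ - Bf A b a (d -e a)))
    by-cases (yes refl) = trans (÷₀-self (ℕ→ℤ→ℚ-≢0 real)) (sym (trans
      (cong₂ _*_ (÷₀-self (degree-≢0 d a real)) (÷₀-self (1-x≢0 B≢1))) (ℚP.*-identityˡ 1ℚ)))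
    by-cases (no a≢b) = ratio-from-balance (ℕ→ℤ→ℚ-≢0 real) (degree-≢0 d b real) (1-x≢0 B≢1) (begin
        ℤ→ℚ (d a) * ℤ→ℚ (+ 𝒩 A (d -e b)) * (1ℚ - Bf A a b (d -e b))
      ≡⟨ cong (λ z → ℤ→ℚ z * ℤ→ℚ (+ 𝒩 A (d -e b)) * (1ℚ - Bf A a b (d -e b))) (sym (-e-other d a≢b)) ⟩
        ℤ→ℚ ((d -e b) a) * ℤ→ℚ (+ 𝒩 A (d -e b)) * (1ℚ - Bf A a b (d -e b))
      ≡⟨ complement-B a b (d -e b) ⟩
        ℤ→ℚ (+ 𝒮 a b (d -e b))
      ≡⟨ cong (λ z → ℤ→ℚ (+ z)) (switching d a b a≢b) ⟩
        ℤ→ℚ (+ 𝒮 b a (d -e a))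
      ≡⟨ sym (complement-B b a (d -e a)) ⟩
        ℤ→ℚ ((d -e a) b) * ℤ→ℚ (+ 𝒩 A (d -e a)) * (1ℚ - Bf A b a (d -e a))
      ≡⟨ cong (λ z → ℤ→ℚ z * ℤ→ℚ (+ 𝒩 A (d -e a)) * (1ℚ - Bf A b a (d -e a))) (-e-other d (λ b≡a → a≢b (sym b≡a))) ⟩
        ℤ→ℚ (d b) * ℤ→ℚ (+ 𝒩 A (d -e a)) * (1ℚ - Bf A b a (d -e a)) ∎)

  -- By (I), 𝒩(d−e_b−e_v) ≥ 𝒩_bv(d) > 0 and 1 − P_bv(d−e_b−e_v) = 𝒩_bv(d) / 𝒩(d−e_b−e_v).
  toggled-realisable : ∀ d b v → 0 < 𝒩edge A d b v → 0 < 𝒩 A ((d -e b) -e v)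
  toggled-realisable d b v h =
    ℕP.<-≤-trans h (subst (𝒩edge A d b v ≤_) (edge-toggle d b v h) (ℕP.m≤m+n _ _))

  complement-Pe : ∀ d b v → 0 < 𝒩edge A d b v →
    1ℚ - Pe A ((d -e b) -e v) b v ≡ ℤ→ℚ (+ 𝒩edge A d b v) ÷₀ ℤ→ℚ (+ 𝒩 A ((d -e b) -e v))
  complement-Pe d b v h =
    complement-fraction (𝒩edge A d b v) (𝒩edge A ((d -e b) -e v) b v) (𝒩 A ((d -e b) -e v)) (edge-toggle d b v h) (ℕ→ℤ→ℚ-≢0 (toggled-realisable d b v h))

  summand : ∀ d a b v → 0 < 𝒩edge A d a v → 0 < 𝒩edge A d b v →
    R A b a (d -e v) * ((1ℚ - Pe A ((d -e b) -e v) b v) ÷₀ (1ℚ - Pe A ((d -e a) -e v) a v))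
      ≡ ℤ→ℚ (+ 𝒩edge A d b v) ÷₀ ℤ→ℚ (+ 𝒩edge A d a v)
  summand d a b v ha hb = trans
    (cong₂ _*_
      (cong₂ (λ x y → ℤ→ℚ (+ x) ÷₀ ℤ→ℚ (+ y)) (𝒩-cong (-e-comm d v b)) (𝒩-cong (-e-comm d v a)))
      (cong₂ _÷₀_ (complement-Pe d b v hb) (complement-Pe d a v ha)))
    (quotient-of-ratios (ℕ→ℤ→ℚ-≢0 (toggled-realisable d a v ha)) (ℕ→ℤ→ℚ-≢0 (toggled-realisable d b v hb))
                        (ℕ→ℤ→ℚ-≢0 ha))

  -- Restricting the degree sum (II) to 𝒜*(v) drops only vanishing terms.
  sum-over-𝒜* : ∀ d v → sumL (λ b → 𝒩edge A d b v) (𝒜* A d v) ≡ sumL (λ b → 𝒩edge A d b v) (allFin n)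
  sum-over-𝒜* d v = trans
    (sumL-filter-vanishing (λ b → adj A v b Bool.≟ true) f
      (λ b v≁b → not-positive (λ h → v≁b (trans (adj-sym v b) (𝒩edge-allowed d b v h))))
      (filter (λ b → 0 ℕ.<? 𝒩edge A d b v) (allFin n)))
    (sumL-filter-vanishing (λ b → 0 ℕ.<? 𝒩edge A d b v) f (λ b → not-positive) (allFin n))
    where
    f = λ b → 𝒩edge A d b v
    not-positive : ∀ {x} → ¬ (0 < x) → x ≡ 0
    not-positive {zero} _ = refl
    not-positive {suc x} h = ⊥-elim (h (s≤s z≤n))

  part-a : ∀ d (a v : Fin n) → 0 < 𝒩edge A d a v →
    Pe A d a v ≡ ℤ→ℚ (d v) * (1ℚ ÷₀ sumℚ (map (λ b → R A b a (d -e v)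
        * ((1ℚ - Pe A ((d -e b) -e v) b v) ÷₀ (1ℚ - Pe A ((d -e a) -e v) a v))) (𝒜* A d v)))
  part-a d a v h = trans (quotient-as-reciprocal (ℕ→ℤ→ℚ-≢0 h) N≢0 dᵥ≢0)
                         (cong (λ z → ℤ→ℚ (d v) * (1ℚ ÷₀ z)) (sym summands-total))
    where
    f = λ b → 𝒩edge A d b v
    N≢0 : ℤ→ℚ (+ 𝒩 A d) ≢ 0ℚ
    N≢0 = ℕ→ℤ→ℚ-≢0 (ℕP.<-≤-trans h (𝒩edge-≤ d a v))
    -- d_v = 0 would force every 𝒩_bv(d) to vanish by (II)
    dᵥ≢0 : ℤ→ℚ (d v) ≢ 0ℚ
    dᵥ≢0 = ℤ→ℚ-≢0 (d v) (λ dᵥ≡0 → ℕP.<⇒≢ (ℕP.<-≤-trans h (sumL-allFin-≥ n f a))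
      (sym (ℤP.+-injective (trans (degree-sum d v) (cong (ℤ._* + 𝒩 A d) dᵥ≡0)))))
    summands-positive : All (λ b → 0 < f b) (𝒜* A d v)
    summands-positive = AllP.filter⁺ (λ b → adj A v b Bool.≟ true)
      (AllP.all-filter (λ b → 0 ℕ.<? 𝒩edge A d b v) (allFin n))
    summands-total : sumℚ (map (λ b → R A b a (d -e v)
        * ((1ℚ - Pe A ((d -e b) -e v) b v) ÷₀ (1ℚ - Pe A ((d -e a) -e v) a v))) (𝒜* A d v))
      ≡ (ℤ→ℚ (d v) * ℤ→ℚ (+ 𝒩 A d)) ÷₀ ℤ→ℚ (+ f a)
    summands-total = begin
        sumℚ (map (λ b → R A b a (d -e v)
          * ((1ℚ - Pe A ((d -e b) -e v) b v) ÷₀ (1ℚ - Pe A ((d -e a) -e v) a v))) (𝒜* A d v))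
      ≡⟨ sumℚ-cong-All (λ b → summand d a b v h) summands-positive ⟩
        sumℚ (map (λ b → ℤ→ℚ (+ f b) ÷₀ ℤ→ℚ (+ f a)) (𝒜* A d v))
      ≡⟨ sumℚ-÷₀ (λ b → ℤ→ℚ (+ f b)) (ℤ→ℚ (+ f a)) (𝒜* A d v) ⟩
        sumℚ (map (λ b → ℤ→ℚ (+ f b)) (𝒜* A d v)) ÷₀ ℤ→ℚ (+ f a)
      ≡⟨ cong (_÷₀ ℤ→ℚ (+ f a)) (trans (sumℚ-ℤ→ℚ f (𝒜* A d v)) (cong (λ z → ℤ→ℚ (+ z)) (sum-over-𝒜* d v))) ⟩
        ℤ→ℚ (+ sumL f (allFin n)) ÷₀ ℤ→ℚ (+ f a)
      ≡⟨ cong (λ z → ℤ→ℚ z ÷₀ ℤ→ℚ (+ f a)) (degree-sum d v) ⟩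
        ℤ→ℚ (d v ℤ.* + 𝒩 A d) ÷₀ ℤ→ℚ (+ f a)
      ≡⟨ cong (_÷₀ ℤ→ℚ (+ f a)) (ℤ→ℚ-* (d v) (+ 𝒩 A d)) ⟩
        (ℤ→ℚ (d v) * ℤ→ℚ (+ 𝒩 A d)) ÷₀ ℤ→ℚ (+ f a) ∎

open import Data.Nat using (_<_)
open import Data.Rational using (_*_; _-_)

proposition3p1 : (n : ℕ) (A : Allowed n) (d : Fin n → ℤ) →
    ((a v : Fin n) → 0 < 𝒩edge A d a v →
      Pe A d a v ≡ ℤ→ℚ (d v) * (1ℚ ÷₀ sumℚ (map (λ b → R A b a (d -e v)
          * ((1ℚ - Pe A ((d -e b) -e v) b v) ÷₀ (1ℚ - Pe A ((d -e a) -e v) a v)))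
          (𝒜* A d v))))
  × ((a b : Fin n) → Realisable A (d -e b) → Bf A b a (d -e a) ≢ 1ℚ →
      R A a b d ≡ (ℤ→ℚ (d a) ÷₀ ℤ→ℚ (d b))
        * ((1ℚ - Bf A a b (d -e b)) ÷₀ (1ℚ - Bf A b a (d -e a))))
proposition3p1 n A d = Formulas.part-a n A d , Formulas.part-b n A d
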